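{- Let $p$ be a prime and $f(x)=x^{d_2}+c_1x^{d_1}\in\overline{\mathbb{F}}_p[x]$ with $c_1\in\overline{\mathbb{F}}_p^*$, $1\le d_1<d_2$, $d_i=p^{\ell_i}s_i$ with $\ell_i\ge0$, $p\nmid s_i$, and assume $s_2>1$ and $p^{\ell_2}(s_2-1)<p^{\ell_1}(s_1-1)$. For an indeterminate $\lambda$ let $f_\lambda(x)=f(x)+\lambda$. Then for each integer $n\ge1$, $$f_\lambda^n(x)=\sum_{i=0}^{d_2^{n-1}}c_{n,i}(x)\lambda^{d_2^{n-1}-i}$$ for some polynomials $c_{n,i}\in\overline{\mathbb{F}}_p[x]$, and these satisfy: (a) $c_{n,0}(x)=1$ and $c_{n,d_2^{n-1}}(x)=f^n(x)$; (b) $\deg c_{n,i}\le d_2\cdot i$ for $i=0,1,\ldots,d_2^{n-1}$; (c) among the terms $c_{n,i}(x)\lambda^{d_2^{n-1}-i}$ with $\deg_x c_{n,i}>0$, the one of highest degree in $\lambda$ is $a_n(x)\lambda^{b_n}$, where $a_1(x)=f(x)$, $b_1=0$, $a_2(x)=c_1s_1f(x)^{p^{\ell_1}}$, $b_2=p^{\ell_1}(s_1-1)$, and for every $n\ge2$, $b_{n+1}=p^{\ell_2}(d_2^{n-1}(s_2-1)+b_n)$ and $a_{n+1}(x)=s_2a_n(x)^{p^{\ell_2}}+u_n$ for some $u_n\in\overline{\mathbb{F}}_p$.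
   Context: $f^n$ and $f_\lambda^n$ denote $n$-fold iterates under composition. -}

module Defs where

open import Level using (Level)
open import Algebra.Bundles using (CommutativeRing)
open import Data.Nat as ℕ using (ℕ; zero; suc; _∸_; _≟_)
open import Data.List using (List; []; _∷_)
open import Data.Product using (Σ; ∃; _×_; _,_)
open import Relation.Binary.PropositionalEquality using (_≡_)
open import Relation.Nullary using (¬_; yes; no)

module _ {c ℓ : Level} (R : CommutativeRing c ℓ) where
  open CommutativeRing R hiding (zero)

  ι : ℕ → Carrier
  ι zero = 0#
  ι (suc n) = 1# + ι n

  IsField : Set (c Level.⊔ ℓ)
  IsField = (¬ (1# ≈ 0#)) × (∀ x → ¬ (x ≈ 0#) → ∃ λ y → x * y ≈ 1#)

  HasChar : ℕ → Set ℓ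
  HasChar p = ι p ≈ 0#

  evalPoly : List Carrier → Carrier → Carrier
  evalPoly [] x = 0#
  evalPoly (a ∷ as) x = a + x * evalPoly as x

  xpow : Carrier → ℕ → Carrier
  xpow x zero = 1#
  xpow x (suc n) = x * xpow x n

  -- a monic polynomial of degree m (m ≥ 1) with lower coefficients as
  -- (only the first m entries used; missing entries are 0)
  take : ℕ → List Carrier → List Carrier
  take zero _ = []
  take (suc m) [] = 0# ∷ take m []
  take (suc m) (a ∷ as) = a ∷ take m as

  evalMonic : ℕ → List Carrier → Carrier → Carrier
  evalMonic m as x = xpow x m + evalPoly (take m as) x

  AlgClosed : Set (c Level.⊔ ℓ)
  AlgClosed = ∀ (m : ℕ) → 1 ℕ.≤ m → (as : List Carrier) →
              ∃ λ x → evalMonic m as x ≈ 0#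

  mapι : List ℕ → List Carrier
  mapι [] = []
  mapι (a ∷ as) = ι a ∷ mapι as

  -- every element is algebraic over the prime subfield (image of ℕ)
  AlgebraicOverPrime : Set (c Level.⊔ ℓ)
  AlgebraicOverPrime = ∀ x → ∃ λ m → 1 ℕ.≤ m × ∃ λ (as : List ℕ) →
                       evalMonic m (mapι as) x ≈ 0#

  IsAlgClosureOfFp : ℕ → Set (c Level.⊔ ℓ)
  IsAlgClosureOfFp p = IsField × HasChar p × AlgClosed × AlgebraicOverPrime

  -- Bivariate polynomials in x and λ, represented by coefficient
  -- functions: S m j = coefficient of λ^m x^j.  (All objects built below
  -- from polynomials by ring operations have finite support.)
  Ser : Set c
  Ser = ℕ → ℕ → Carrier

  sumTo : ℕ → (ℕ → Carrier) → Carrier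
  sumTo zero g = g zero
  sumTo (suc m) g = sumTo m g + g (suc m)

  _⊕_ : Ser → Ser → Ser
  (A ⊕ B) m j = A m j + B m j

  _⊗_ : Ser → Ser → Ser
  (A ⊗ B) m j = sumTo m λ a → sumTo j λ b → A a b * B (m ∸ a) (j ∸ b)

  const : Carrier → Ser
  const r zero zero = r
  const r _ _ = 0#

  one : Ser
  one = const 1#

  _^ˢ_ : Ser → ℕ → Ser
  A ^ˢ zero = one
  A ^ˢ suc n = A ⊗ (A ^ˢ n)

  X : Ser
  X zero (suc zero) = 1#
  X _ _ = 0#

  Λ : Ser
  Λ (suc zero) zero = 1#
  Λ _ _ = 0#

  coeffλ : Ser → ℕ → Ser
  coeffλ A m zero j = A m j
  coeffλ A m (suc _) j = 0#

  _≈ˢ_ : Ser → Ser → Set ℓ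
  A ≈ˢ B = ∀ m j → A m j ≈ B m j

  module Iter (d₁ d₂ : ℕ) (c₁ : Carrier) where
    fAt : Ser → Ser
    fAt P = (P ^ˢ d₂) ⊕ (const c₁ ⊗ (P ^ˢ d₁))

    fλAt : Ser → Ser
    fλAt P = fAt P ⊕ Λ

    fIter : ℕ → Ser
    fIter zero = X
    fIter (suc n) = fAt (fIter n)

    fλIter : ℕ → Ser
    fλIter zero = X
    fλIter (suc n) = fλAt (fλIter n)

    cc : ℕ → ℕ → Ser
    cc n i = coeffλ (fλIter n) ((d₂ ℕ.^ (n ∸ 1)) ∸ i)

bSeq : (p ℓ₁ s₁ ℓ₂ s₂ d₂ : ℕ) → ℕ → ℕ
bSeq p ℓ₁ s₁ ℓ₂ s₂ d₂ zero = 0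
bSeq p ℓ₁ s₁ ℓ₂ s₂ d₂ (suc zero) = 0
bSeq p ℓ₁ s₁ ℓ₂ s₂ d₂ (suc (suc zero)) = (p ℕ.^ ℓ₁) ℕ.* (s₁ ∸ 1)
bSeq p ℓ₁ s₁ ℓ₂ s₂ d₂ (suc (suc (suc k))) =
  (p ℕ.^ ℓ₂) ℕ.* ((d₂ ℕ.^ (suc k)) ℕ.* (s₂ ∸ 1) ℕ.+ bSeq p ℓ₁ s₁ ℓ₂ s₂ d₂ (suc (suc k)))

open import Data.Nat using (_<_; _≤_)

module _ {c ℓ : Level} (K : CommutativeRing c ℓ) where
  open CommutativeRing K using (Carrier; _≈_; 0#; _*_)

  Lemma5p1Conclusion : (p : ℕ) (c₁ : Carrier) (d₁ d₂ ℓ₁ ℓ₂ s₁ s₂ : ℕ) (n : ℕ) → Set (c Level.⊔ ℓ)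
  Lemma5p1Conclusion p c₁ d₁ d₂ ℓ₁ ℓ₂ s₁ s₂ n =
       -- f_λ^n(x) = Σ_{i=0}^{D} c_{n,i}(x) λ^{D-i}: no powers λ^m with m > D
       (∀ m j → D < m → fλIter n m j ≈ 0#)
       × (cc n 0 ≈ˢ' one K)
       × (cc n D ≈ˢ' fIter n)
       × (∀ i j → i ≤ D → d₂ ℕ.* i < j → cc n i 0 j ≈ 0#)
       × (b n ≤ D)
       × (∃ λ j → 1 ≤ j × ¬ (fλIter n (b n) j ≈ 0#))
       × (∀ m j → b n < m → 1 ≤ j → fλIter n m j ≈ 0#)
       × (n ≡ 1 → a 1 ≈ˢ' fAt (X K))
       × (n ≡ 1 → a 2 ≈ˢ' _⊗_ K (const K (c₁ * ι K s₁)) (_^ˢ_ K (fAt (X K)) (p ℕ.^ ℓ₁)))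
       × (2 ≤ n → ∃ λ u →
            a (suc n) ≈ˢ' _⊕_ K (_⊗_ K (const K (ι K s₂)) (_^ˢ_ K (a n) (p ℕ.^ ℓ₂))) (const K u))
    where
      open Iter K d₁ d₂ c₁
      _≈ˢ'_ = _≈ˢ_ K
      b = bSeq p ℓ₁ s₁ ℓ₂ s₂ d₂
      D = d₂ ℕ.^ (n ∸ 1)
      -- a_k(x) := c_{k, d₂^{k-1} - b_k}(x), the coefficient of λ^{b_k} in f_λ^k
      a : ℕ → Ser K
      a k = cc k (d₂ ℕ.^ (k ∸ 1) ∸ b k)

{-# OPTIONS --safe #-}

-- Write P_n = f_λ^n(x) as a polynomial in λ over K[x].  Then P_n is monic of λ-degree
-- D_n = d₂^(n-1), and its λ^m-coefficients are constants for all m > b_n.  For q = p^l,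
-- Frobenius gives P^q = Q^q + A^q + R^q, where Q is the x-free part of P, A its λ^b-row a
-- and R the rows below; so P^(qs) has the same shape, its x-dependence stops at
-- λ^((s-1)qD+qb), and the x-dependent part of the coefficient there is that of s·a^q.
-- In P_(n+1) = P_n^d₂ + c₁ P_n^d₁ + λ the larger of the two exponents
-- B₂ = (s₂-1)q₂D + q₂b and B₁ = (s₁-1)q₁D + q₁b wins.  For n = 1 this is B₁, by
-- p^ℓ₂(s₂-1) < p^ℓ₁(s₁-1).  For n ≥ 2 it is B₂, by the invariant
-- (X₁ - X₂)·D_n < (q₂ - q₁)·b_n (X_i = q_i(s_i - 1)), which holds for n = 2 because q₁ divides
-- both d₁ < d₂, and survives each step because b_n ≤ D_n.  The leading x-coefficients stay
-- nonzero because p ∤ s_i and K is a field.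

module Submission where

open import Level using (Level; _⊔_)
open import Algebra.Bundles using (CommutativeRing)
open import Algebra.Structures using (IsCommutativeRing)
import Algebra.Construct.Pointwise as Pointwise
import Algebra.Consequences.Setoid as Consequences
open import Data.Nat using (ℕ; zero; suc; _∸_; _≤_; _<_; z≤n; s≤s)
import Data.Nat as ℕ
import Data.Nat.Properties as ℕₚ
open import Data.Product using (_,_; proj₁; proj₂; ∃)
open import Data.Nat.Tactic.RingSolver using (solve-∀)
open import Data.Sum using (inj₁; inj₂)
open import Data.Fin using (toℕ)
open import Data.Nat.Combinatorics using (_C_; nC1≡n; nCn≡1; nCk+nC[k+1]≡[n+1]C[k+1])
open import Data.Nat.Combinatorics.Specification using (k>n⇒nCk≡0)
open import Data.Nat.Divisibility using (_∣_; divides; ∣⇒≤)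
open import Data.Nat.Primality using (Prime; euclidsLemma; prime⇒nonZero; prime⇒irreducible)
open import Data.Nat.GCD using (module GCD; module Bézout)
open import Function using (_∘_)
open import Relation.Binary.PropositionalEquality as ≡ using (_≡_; _≢_)
open import Relation.Nullary using (¬_; yes; no; contradiction)
open import Relation.Binary using (tri<; tri≈; tri>)
open import Relation.Binary.Bundles using (Setoid)
import Relation.Binary.Reasoning.Setoid as ≈-Reasoning
import Defs as D
open import Defs using (IsAlgClosureOfFp; Lemma5p1Conclusion)

open import Algebra.Properties.CommutativeSemigroup ℕₚ.+-commutativeSemigroup
  using () renaming (x∙yz≈y∙xz to m+[n+o]≡n+[m+o])

[1+s]*[q*D]≡q*[1+s]*D : ∀ s q D → suc s ℕ.* (q ℕ.* D) ≡ q ℕ.* suc s ℕ.* D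
[1+s]*[q*D]≡q*[1+s]*D = solve-∀

m*n>0 : ∀ {m n} → 0 < m → 0 < n → 0 < m ℕ.* n
m*n>0 {suc m} {suc n} _ _ = s≤s z≤n

+<⇒<∸ : ∀ n a {m} → n ℕ.+ a < m → n < m ∸ a
+<⇒<∸ n a = ℕₚ.m+n≤o⇒m≤o∸n (suc n)

module RingFacts {c ℓ : Level} (R : CommutativeRing c ℓ) where
  open CommutativeRing R

  x≈0⇒x*y≈0 : ∀ {x y} → x ≈ 0# → x * y ≈ 0#
  x≈0⇒x*y≈0 x≈0 = trans (*-congʳ x≈0) (zeroˡ _)

  y≈0⇒x*y≈0 : ∀ {x y} → y ≈ 0# → x * y ≈ 0#
  y≈0⇒x*y≈0 y≈0 = trans (*-congˡ y≈0) (zeroʳ _)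

  0+0+0≈0 : ∀ {x y z} → x ≈ 0# → y ≈ 0# → z ≈ 0# → x + y + z ≈ 0#
  0+0+0≈0 x≈0 y≈0 z≈0 = trans (+-cong (+-cong x≈0 y≈0) z≈0) (trans (+-identityʳ _) (+-identityʳ 0#))

  open import Algebra.Properties.Semiring.Exp semiring using (_^_)

  1^n≈1 : ∀ n → 1# ^ n ≈ 1#
  1^n≈1 zero = refl
  1^n≈1 (suc n) = trans (*-identityˡ _) (1^n≈1 n)

module FiniteSums {c ℓ : Level} (R : CommutativeRing c ℓ) where
  open CommutativeRing R
  open ≈-Reasoning setoid
  open import Algebra.Properties.CommutativeSemigroup +-commutativeSemigroup
    using () renaming (interchange to +-interchange)

  ∑ : ℕ → (ℕ → Carrier) → Carrier
  ∑ = D.sumTo R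

  ∑-cong : ∀ m {f g} → (∀ i → i ≤ m → f i ≈ g i) → ∑ m f ≈ ∑ m g
  ∑-cong zero f≈g = f≈g 0 z≤n
  ∑-cong (suc m) f≈g =
    +-cong (∑-cong m (λ i i≤m → f≈g i (ℕₚ.m≤n⇒m≤1+n i≤m))) (f≈g (suc m) ℕₚ.≤-refl)

  ∑-zero : ∀ m {f} → (∀ i → i ≤ m → f i ≈ 0#) → ∑ m f ≈ 0#
  ∑-zero zero f≈0 = f≈0 0 z≤n
  ∑-zero (suc m) f≈0 = trans (+-cong (∑-zero m (λ i i≤m → f≈0 i (ℕₚ.m≤n⇒m≤1+n i≤m)))
                                    (f≈0 (suc m) ℕₚ.≤-refl))
                             (+-identityˡ 0#)

  ∑-+ : ∀ m f g → ∑ m (λ i → f i + g i) ≈ ∑ m f + ∑ m g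
  ∑-+ zero f g = refl
  ∑-+ (suc m) f g = trans (+-congʳ (∑-+ m f g)) (+-interchange _ _ _ _)

  ∑-distribˡ : ∀ m x f → x * ∑ m f ≈ ∑ m (λ i → x * f i)
  ∑-distribˡ zero x f = refl
  ∑-distribˡ (suc m) x f = trans (distribˡ _ _ _) (+-congʳ (∑-distribˡ m x f))

  ∑-distribʳ : ∀ m x f → ∑ m f * x ≈ ∑ m (λ i → f i * x)
  ∑-distribʳ zero x f = refl
  ∑-distribʳ (suc m) x f = trans (distribʳ _ _ _) (+-congʳ (∑-distribʳ m x f))

  ∑-unfoldˡ : ∀ m f → ∑ (suc m) f ≈ f 0 + ∑ m (λ i → f (suc i))
  ∑-unfoldˡ zero f = refl
  ∑-unfoldˡ (suc m) f = trans (+-congʳ (∑-unfoldˡ m f)) (+-assoc _ _ _)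

  ∑-reverse : ∀ m f → ∑ m f ≈ ∑ m (λ i → f (m ∸ i))
  ∑-reverse zero f = refl
  ∑-reverse (suc m) f = begin
    ∑ m f + f (suc m)                       ≈⟨ +-comm _ _ ⟩
    f (suc m) + ∑ m f                       ≈⟨ +-congˡ (∑-reverse m f) ⟩
    f (suc m) + ∑ m (λ i → f (m ∸ i))       ≈⟨ ∑-unfoldˡ m (λ i → f (suc m ∸ i)) ⟨
    ∑ (suc m) (λ i → f (suc m ∸ i))         ∎

  ∑-single : ∀ m k {f} → k ≤ m → (∀ i → i ≤ m → i ≢ k → f i ≈ 0#) → ∑ m f ≈ f k
  ∑-single zero zero _ _ = refl
  ∑-single (suc m) k {f} k≤1+m others with k ℕₚ.≟ suc m
  ... | yes ≡.refl = trans (+-congʳ (∑-zero m (λ i i≤m → others i (ℕₚ.m≤n⇒m≤1+n i≤m) (ℕₚ.<⇒≢ (s≤s i≤m)))))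
                           (+-identityˡ _)
  ... | no k≢1+m = trans (+-congˡ (others (suc m) ℕₚ.≤-refl (k≢1+m ∘ ≡.sym)))
                         (trans (+-identityʳ _)
                                (∑-single m k (ℕₚ.≤-pred (ℕₚ.≤∧≢⇒< k≤1+m k≢1+m))
                                          (λ i i≤m → others i (ℕₚ.m≤n⇒m≤1+n i≤m))))

  ∑-pair : ∀ m k l {f} → k < l → l ≤ m → (∀ i → i ≤ m → i ≢ k → i ≢ l → f i ≈ 0#) →
           ∑ m f ≈ f k + f l
  ∑-pair zero k zero () z≤n _
  ∑-pair (suc m) k l {f} k<l l≤1+m others with l ℕₚ.≟ suc m
  ... | yes ≡.refl = +-congʳ (∑-single m k (ℕₚ.≤-pred k<l)
                       (λ i i≤m i≢k → others i (ℕₚ.m≤n⇒m≤1+n i≤m) i≢k (ℕₚ.<⇒≢ (s≤s i≤m))))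
  ... | no l≢1+m = trans (+-congˡ (others (suc m) ℕₚ.≤-refl (ℕₚ.>⇒≢ (ℕₚ.<-≤-trans k<l l≤1+m)) (l≢1+m ∘ ≡.sym)))
                         (trans (+-identityʳ _)
                                (∑-pair m k l k<l (ℕₚ.≤-pred (ℕₚ.≤∧≢⇒< l≤1+m l≢1+m))
                                        (λ i i≤m → others i (ℕₚ.m≤n⇒m≤1+n i≤m))))

  ∑-interchange : ∀ m (F : ℕ → ℕ → Carrier) →
    ∑ m (λ a → ∑ a (λ i → F i a)) ≈ ∑ m (λ i → ∑ (m ∸ i) (λ k → F i (i ℕ.+ k)))
  ∑-interchange zero F = refl
  ∑-interchange (suc m) F = begin
    ∑ m (λ a → ∑ a (λ i → F i a)) + (∑ m (λ i → F i (suc m)) + F (suc m) (suc m))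
      ≈⟨ +-assoc _ _ _ ⟨
    (∑ m (λ a → ∑ a (λ i → F i a)) + ∑ m (λ i → F i (suc m))) + F (suc m) (suc m)
      ≈⟨ +-congʳ (+-congʳ (∑-interchange m F)) ⟩
    (∑ m (λ i → ∑ (m ∸ i) (λ k → F i (i ℕ.+ k))) + ∑ m (λ i → F i (suc m))) + F (suc m) (suc m)
      ≈⟨ +-cong (∑-+ m _ _) (reflexive (≡.cong (F (suc m)) (ℕₚ.+-identityʳ (suc m)))) ⟨
    ∑ m (λ i → ∑ (m ∸ i) (λ k → F i (i ℕ.+ k)) + F i (suc m)) + F (suc m) (suc m ℕ.+ 0)
      ≈⟨ +-congʳ (∑-cong m extend) ⟩
    ∑ m (λ i → ∑ (suc m ∸ i) (λ k → F i (i ℕ.+ k))) + F (suc m) (suc m ℕ.+ 0)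
      ≡⟨ ≡.cong (λ z → ∑ m (λ i → ∑ (suc m ∸ i) (λ k → F i (i ℕ.+ k))) + ∑ z (λ k → F (suc m) (suc m ℕ.+ k)))
                (ℕₚ.n∸n≡0 m) ⟨
    ∑ (suc m) (λ i → ∑ (suc m ∸ i) (λ k → F i (i ℕ.+ k))) ∎
    where
    extend : ∀ i → i ≤ m →
             ∑ (m ∸ i) (λ k → F i (i ℕ.+ k)) + F i (suc m) ≈ ∑ (suc m ∸ i) (λ k → F i (i ℕ.+ k))
    extend i i≤m rewrite ℕₚ.+-∸-assoc 1 i≤m =
      +-congˡ (reflexive (≡.cong (F i) (≡.trans (≡.sym (ℕₚ.m+[n∸m]≡n (ℕₚ.m≤n⇒m≤1+n i≤m)))
                                                  (≡.cong (i ℕ.+_) (ℕₚ.+-∸-assoc 1 i≤m)))))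

module Convolution {c ℓ : Level} (R : CommutativeRing c ℓ) where
  open CommutativeRing R
  open RingFacts R
  open FiniteSums R
  open ≈-Reasoning setoid

  infix 4 _≋_
  _≋_ : (ℕ → Carrier) → (ℕ → Carrier) → Set ℓ
  f ≋ g = ∀ m → f m ≈ g m

  infixl 7 _⋆_
  _⋆_ : (ℕ → Carrier) → (ℕ → Carrier) → (ℕ → Carrier)
  (f ⋆ g) m = ∑ m (λ a → f a * g (m ∸ a))

  δ₀ : ℕ → Carrier
  δ₀ zero = 1#
  δ₀ (suc _) = 0#

  ⋆-cong : ∀ {f f′ g g′} → f ≋ f′ → g ≋ g′ → f ⋆ g ≋ f′ ⋆ g′
  ⋆-cong f≋f′ g≋g′ m = ∑-cong m (λ a _ → *-cong (f≋f′ a) (g≋g′ (m ∸ a)))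

  ⋆-comm : ∀ f g → f ⋆ g ≋ g ⋆ f
  ⋆-comm f g m = begin
    ∑ m (λ a → f a * g (m ∸ a))             ≈⟨ ∑-reverse m _ ⟩
    ∑ m (λ a → f (m ∸ a) * g (m ∸ (m ∸ a))) ≈⟨ ∑-cong m swap ⟩
    ∑ m (λ a → g a * f (m ∸ a))             ∎
    where
    swap : ∀ a → a ≤ m → f (m ∸ a) * g (m ∸ (m ∸ a)) ≈ g a * f (m ∸ a)
    swap a a≤m = trans (*-comm _ _) (*-congʳ (reflexive (≡.cong g (ℕₚ.m∸[m∸n]≡n a≤m))))

  ⋆-identityˡ : ∀ f → δ₀ ⋆ f ≋ f
  ⋆-identityˡ f m = trans (∑-single m 0 z≤n others) (*-identityˡ (f m))
    where
    others : ∀ i → i ≤ m → i ≢ 0 → δ₀ i * f (m ∸ i) ≈ 0#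
    others zero _ i≢0 = contradiction ≡.refl i≢0
    others (suc i) _ _ = zeroˡ _

  ⋆-distribʳ : ∀ h f g → (λ m → f m + g m) ⋆ h ≋ (λ m → (f ⋆ h) m + (g ⋆ h) m)
  ⋆-distribʳ h f g m = trans (∑-cong m (λ a _ → distribʳ _ _ _)) (∑-+ m _ _)

  ⋆-assoc : ∀ f g h → (f ⋆ g) ⋆ h ≋ f ⋆ (g ⋆ h)
  ⋆-assoc f g h m = begin
    ∑ m (λ a → ∑ a (λ i → f i * g (a ∸ i)) * h (m ∸ a))
      ≈⟨ ∑-cong m (λ a _ → ∑-distribʳ a _ _) ⟩
    ∑ m (λ a → ∑ a (λ i → f i * g (a ∸ i) * h (m ∸ a)))
      ≈⟨ ∑-interchange m (λ i a → f i * g (a ∸ i) * h (m ∸ a)) ⟩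
    ∑ m (λ i → ∑ (m ∸ i) (λ k → f i * g (i ℕ.+ k ∸ i) * h (m ∸ (i ℕ.+ k))))
      ≈⟨ ∑-cong m (λ i _ → ∑-cong (m ∸ i) (λ k _ → reassociate i k)) ⟩
    ∑ m (λ i → ∑ (m ∸ i) (λ k → f i * (g k * h (m ∸ i ∸ k))))
      ≈⟨ ∑-cong m (λ i _ → ∑-distribˡ (m ∸ i) _ _) ⟨
    ∑ m (λ i → f i * ∑ (m ∸ i) (λ k → g k * h (m ∸ i ∸ k))) ∎
    where
    reassociate : ∀ i k → f i * g (i ℕ.+ k ∸ i) * h (m ∸ (i ℕ.+ k)) ≈ f i * (g k * h (m ∸ i ∸ k))
    reassociate i k = trans (*-assoc _ _ _)
      (*-congˡ (*-cong (reflexive (≡.cong g (ℕₚ.m+n∸m≡n i k)))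
                       (reflexive (≡.cong h (≡.sym (ℕₚ.∸-+-assoc m i k))))))

  ≋-setoid : Setoid c ℓ
  ≋-setoid = record { isEquivalence = Pointwise.isEquivalence ℕ isEquivalence }

  ⋆-isCommutativeRing : IsCommutativeRing _≋_ (λ f g m → f m + g m) _⋆_ (λ f m → - f m) (λ _ → 0#) δ₀
  ⋆-isCommutativeRing = record
    { isRing = record
      { +-isAbelianGroup = Pointwise.isAbelianGroup ℕ +-isAbelianGroup
      ; *-cong = ⋆-cong
      ; *-assoc = ⋆-assoc
      ; *-identity = comm∧idˡ⇒id ⋆-comm ⋆-identityˡ
      ; distrib = comm∧distrʳ⇒distr (λ f≋f′ g≋g′ m → +-cong (f≋f′ m) (g≋g′ m)) ⋆-comm ⋆-distribʳ
      }
    ; *-comm = ⋆-comm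
    }
    where open Consequences ≋-setoid

  convolutionRing : CommutativeRing c ℓ
  convolutionRing = record { isCommutativeRing = ⋆-isCommutativeRing }

  ι-convolution-zero : ∀ n → D.ι convolutionRing n 0 ≈ D.ι R n
  ι-convolution-zero zero = refl
  ι-convolution-zero (suc n) = +-congˡ (ι-convolution-zero n)

  ι-convolution-suc : ∀ n m → D.ι convolutionRing n (suc m) ≈ 0#
  ι-convolution-suc zero m = refl
  ι-convolution-suc (suc n) m = trans (+-identityˡ _) (ι-convolution-suc n m)

  convolution-HasChar : ∀ p → D.HasChar R p → D.HasChar convolutionRing p
  convolution-HasChar p char zero = trans (ι-convolution-zero p) char
  convolution-HasChar p char (suc m) = ι-convolution-suc p m

  open import Algebra.Properties.Semiring.Exp semiring using (_^_)
  open import Algebra.Properties.Semiring.Exp (CommutativeRing.semiring convolutionRing)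
    using () renaming (_^_ to _^⋆_) public

  record Leading (f : ℕ → Carrier) (e : ℕ) (α : Carrier) : Set ℓ where
    field
      vanishes-above : ∀ m → e < m → f m ≈ 0#
      leading : f e ≈ α

  open Leading public

  Leading-cong : ∀ {f g e α β} → f ≋ g → α ≈ β → Leading f e α → Leading g e β
  Leading-cong f≋g α≈β L = record
    { vanishes-above = λ m e<m → trans (sym (f≋g m)) (vanishes-above L m e<m)
    ; leading = trans (sym (f≋g _)) (trans (leading L) α≈β)
    }

  Leading-δ₀ : Leading δ₀ 0 1#
  Leading-δ₀ = record { vanishes-above = λ { (suc m) _ → refl } ; leading = refl }

  Leading-⋆ : ∀ {f g e e′ α β} → Leading f e α → Leading g e′ β → Leading (f ⋆ g) (e ℕ.+ e′) (α * β)
  Leading-⋆ {f} {g} {e} {e′} {α} {β} Lf Lg = record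
    { vanishes-above = λ m e+e′<m → ∑-zero m (λ a _ → beyond m a e+e′<m)
    ; leading = begin
        (f ⋆ g) (e ℕ.+ e′)                ≈⟨ ∑-single (e ℕ.+ e′) e (ℕₚ.m≤m+n e e′) others ⟩
        f e * g (e ℕ.+ e′ ∸ e)            ≡⟨ ≡.cong (λ i → f e * g i) (ℕₚ.m+n∸m≡n e e′) ⟩
        f e * g e′                        ≈⟨ *-cong (leading Lf) (leading Lg) ⟩
        α * β                             ∎
    }
    where
    beyond : ∀ m a → e ℕ.+ e′ < m → f a * g (m ∸ a) ≈ 0#
    beyond m a e+e′<m with e ℕₚ.<? a
    ... | yes e<a = x≈0⇒x*y≈0 (vanishes-above Lf a e<a)
    ... | no e≮a = y≈0⇒x*y≈0 (vanishes-above Lg (m ∸ a)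
                     (+<⇒<∸ e′ a (ℕₚ.≤-<-trans (ℕₚ.+-monoʳ-≤ e′ (ℕₚ.≮⇒≥ e≮a))
                                               (≡.subst (_< m) (ℕₚ.+-comm e e′) e+e′<m))))
    others : ∀ a → a ≤ e ℕ.+ e′ → a ≢ e → f a * g (e ℕ.+ e′ ∸ a) ≈ 0#
    others a _ a≢e with ℕₚ.<-cmp a e
    ... | tri< a<e _ _ = y≈0⇒x*y≈0 (vanishes-above Lg _
                           (+<⇒<∸ e′ a (≡.subst (e′ ℕ.+ a <_) (ℕₚ.+-comm e′ e) (ℕₚ.+-monoʳ-< e′ a<e))))
    ... | tri≈ _ a≡e _ = contradiction a≡e a≢e
    ... | tri> _ _ e<a = x≈0⇒x*y≈0 (vanishes-above Lf a e<a)

  Leading-+ : ∀ {f g : ℕ → Carrier} {e α} → Leading f e α → (∀ m → e ≤ m → g m ≈ 0#) → Leading (λ m → f m + g m) e α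
  Leading-+ Lf g≈0 = record
    { vanishes-above = λ m e<m → trans (+-cong (vanishes-above Lf m e<m) (g≈0 m (ℕₚ.<⇒≤ e<m))) (+-identityʳ 0#)
    ; leading = trans (+-cong (leading Lf) (g≈0 _ ℕₚ.≤-refl)) (+-identityʳ _)
    }

  Leading-^ : ∀ {f e α} → Leading f e α → ∀ k → Leading (f ^⋆ k) (k ℕ.* e) (α ^ k)
  Leading-^ Lf zero = Leading-δ₀
  Leading-^ Lf (suc k) = Leading-⋆ Lf (Leading-^ Lf k)

[1+k]*[1+n]C[1+k]≡[1+n]*nCk : ∀ n k → suc k ℕ.* (suc n C suc k) ≡ suc n ℕ.* (n C k)
[1+k]*[1+n]C[1+k]≡[1+n]*nCk zero zero = ≡.refl
[1+k]*[1+n]C[1+k]≡[1+n]*nCk zero (suc k)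
  rewrite k>n⇒nCk≡0 {1} {suc (suc k)} (s≤s (s≤s z≤n)) | k>n⇒nCk≡0 {0} {suc k} (s≤s z≤n) =
  ℕₚ.*-zeroʳ (suc (suc k))
[1+k]*[1+n]C[1+k]≡[1+n]*nCk (suc n) zero rewrite nC1≡n (suc (suc n)) | ℕₚ.*-identityʳ n =
  ℕₚ.+-identityʳ _
[1+k]*[1+n]C[1+k]≡[1+n]*nCk (suc n) (suc k) = begin
  suc (suc k) ℕ.* (suc (suc n) C suc (suc k))
    ≡⟨ ≡.cong (suc (suc k) ℕ.*_) (nCk+nC[k+1]≡[n+1]C[k+1] (suc n) (suc k)) ⟨
  suc (suc k) ℕ.* (A ℕ.+ B)
    ≡⟨ ℕₚ.*-distribˡ-+ (suc (suc k)) A B ⟩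
  (A ℕ.+ suc k ℕ.* A) ℕ.+ suc (suc k) ℕ.* B
    ≡⟨ ≡.cong₂ (λ u v → (A ℕ.+ u) ℕ.+ v) ([1+k]*[1+n]C[1+k]≡[1+n]*nCk n k)
                                          ([1+k]*[1+n]C[1+k]≡[1+n]*nCk n (suc k)) ⟩
  (A ℕ.+ suc n ℕ.* (n C k)) ℕ.+ suc n ℕ.* (n C suc k)
    ≡⟨ ℕₚ.+-assoc A _ _ ⟩
  A ℕ.+ (suc n ℕ.* (n C k) ℕ.+ suc n ℕ.* (n C suc k))
    ≡⟨ ≡.cong (A ℕ.+_) (ℕₚ.*-distribˡ-+ (suc n) (n C k) (n C suc k)) ⟨
  A ℕ.+ suc n ℕ.* (n C k ℕ.+ n C suc k)
    ≡⟨ ≡.cong (λ u → A ℕ.+ suc n ℕ.* u) (nCk+nC[k+1]≡[n+1]C[k+1] n k) ⟩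
  suc (suc n) ℕ.* A ∎
  where
  open ≡.≡-Reasoning
  A = suc n C suc k
  B = suc n C suc (suc k)

p∣pCk : ∀ {p k} → Prime p → 0 < k → k < p → p ∣ p C k
p∣pCk {suc n} {suc k} pp _ k<p
  with euclidsLemma (suc k) (suc n C suc k) pp
         (divides (n C k) (≡.trans ([1+k]*[1+n]C[1+k]≡[1+n]*nCk n k) (ℕₚ.*-comm (suc n) _)))
... | inj₁ p∣1+k = contradiction (∣⇒≤ p∣1+k) (ℕₚ.<⇒≱ k<p)
... | inj₂ p∣pCk = p∣pCk

module Characteristic {c ℓ : Level} (R : CommutativeRing c ℓ) where
  open CommutativeRing R
  open ≈-Reasoning setoid
  open import Algebra.Properties.Semiring.Mult semiring using (_×_; ×-assoc-*; ×-congʳ; ×1-homo-*)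
  open import Algebra.Properties.Monoid.Mult +-monoid using (×-homo-1; ×-assocˡ)
  open import Algebra.Properties.Semiring.Exp semiring using (_^_; ^-assocʳ; ^-congˡ)
  open import Algebra.Properties.CommutativeSemiring.Binomial commutativeSemiring
    using (theorem; binomialExpansion)
  open import Algebra.Properties.Monoid.Sum +-monoid using (sum)
  open FiniteSums R

  ι = D.ι R

  ι≈×1 : ∀ n → ι n ≈ n × 1#
  ι≈×1 zero = refl
  ι≈×1 (suc n) = +-congˡ (ι≈×1 n)

  ι-* : ∀ m n → ι (m ℕ.* n) ≈ ι m * ι n
  ι-* m n = trans (ι≈×1 (m ℕ.* n)) (trans (×1-homo-* m n) (sym (*-cong (ι≈×1 m) (ι≈×1 n))))

  ×-0# : ∀ n → n × 0# ≈ 0#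
  ×-0# zero = refl
  ×-0# (suc n) = trans (+-identityˡ _) (×-0# n)

  module _ {p : ℕ} (p-prime : Prime p) (char : D.HasChar R p) where

    p×≈0 : ∀ x → p × x ≈ 0#
    p×≈0 x = begin
      p × x          ≈⟨ ×-congʳ p (*-identityˡ x) ⟨
      p × (1# * x)   ≈⟨ ×-assoc-* p 1# x ⟨
      (p × 1#) * x   ≈⟨ *-congʳ (trans (sym (ι≈×1 p)) char) ⟩
      0# * x         ≈⟨ zeroˡ x ⟩
      0#             ∎

    pCk×≈0 : ∀ k x → 0 < k → k < p → (p C k) × x ≈ 0#
    pCk×≈0 k x 0<k k<p with p∣pCk p-prime 0<k k<p
    ... | divides t pCk≡t*p = begin
      (p C k) × x      ≡⟨ ≡.cong (_× x) pCk≡t*p ⟩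
      (t ℕ.* p) × x    ≈⟨ ×-assocˡ x t p ⟨
      t × (p × x)      ≈⟨ ×-congʳ t (p×≈0 x) ⟩
      t × 0#           ≈⟨ ×-0# t ⟩
      0#               ∎

    sum≈∑ : ∀ n (h : ℕ → Carrier) → sum {suc n} (λ k → h (toℕ k)) ≈ ∑ n h
    sum≈∑ zero h = +-identityʳ _
    sum≈∑ (suc n) h = trans (+-congˡ (sum≈∑ n (h ∘ suc))) (sym (∑-unfoldˡ n h))

    frobenius : ∀ x y → (x + y) ^ p ≈ x ^ p + y ^ p
    frobenius x y = begin
      (x + y) ^ p                                            ≈⟨ theorem p x y ⟩
      binomialExpansion x y p                                ≈⟨ sum≈∑ p term ⟩
      ∑ p term                                               ≈⟨ ∑-pair p 0 p 0<p ℕₚ.≤-refl inner ⟩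
      term 0 + term p                                        ≡⟨ ≡.cong₂ (λ u i → term 0 + u × (x ^ p * y ^ i))
                                                                        (nCn≡1 p) (ℕₚ.n∸n≡0 p) ⟩
      term 0 + 1 × (x ^ p * 1#)                              ≈⟨ +-cong (×-homo-1 _) (×-homo-1 _) ⟩
      1# * y ^ p + x ^ p * 1#                                ≈⟨ +-cong (*-identityˡ _) (*-identityʳ _) ⟩
      y ^ p + x ^ p                                          ≈⟨ +-comm _ _ ⟩
      x ^ p + y ^ p                                          ∎
      where
      term : ℕ → Carrier
      term k = (p C k) × (x ^ k * y ^ (p ∸ k))
      0<p : 0 < p
      0<p = ℕ.>-nonZero⁻¹ p {{prime⇒nonZero p-prime}}
      inner : ∀ k → k ≤ p → k ≢ 0 → k ≢ p → term k ≈ 0#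
      inner zero _ k≢0 _ = contradiction ≡.refl k≢0
      inner (suc k) k≤p _ k≢p = pCk×≈0 (suc k) _ (s≤s z≤n) (ℕₚ.≤∧≢⇒< k≤p k≢p)

    frobenius-^ : ∀ l x y → (x + y) ^ (p ℕ.^ l) ≈ x ^ (p ℕ.^ l) + y ^ (p ℕ.^ l)
    frobenius-^ zero x y = trans (*-identityʳ (x + y)) (+-cong (sym (*-identityʳ x)) (sym (*-identityʳ y)))
    frobenius-^ (suc l) x y = begin
      (x + y) ^ (p ℕ.* q)                     ≡⟨ ≡.cong ((x + y) ^_) (ℕₚ.*-comm p q) ⟩
      (x + y) ^ (q ℕ.* p)                     ≈⟨ ^-assocʳ (x + y) q p ⟨
      ((x + y) ^ q) ^ p                       ≈⟨ ^-congˡ p (frobenius-^ l x y) ⟩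
      (x ^ q + y ^ q) ^ p                     ≈⟨ frobenius _ _ ⟩
      (x ^ q) ^ p + (y ^ q) ^ p               ≈⟨ +-cong (^-assocʳ x q p) (^-assocʳ y q p) ⟩
      x ^ (q ℕ.* p) + y ^ (q ℕ.* p)           ≡⟨ ≡.cong (λ i → x ^ i + y ^ i) (ℕₚ.*-comm q p) ⟩
      x ^ (p ℕ.* q) + y ^ (p ℕ.* q)           ∎
      where q = p ℕ.^ l

module FieldProperties {c ℓ : Level} (K : CommutativeRing c ℓ) (isField : D.IsField K) where
  open CommutativeRing K
  open ≈-Reasoning setoid
  open import Algebra.Properties.Semiring.Exp semiring using (_^_)
  open Characteristic K using (ι; ι-*)

  1≉0 : ¬ 1# ≈ 0#
  1≉0 = proj₁ isField

  *-≉0 : ∀ {x y} → ¬ x ≈ 0# → ¬ y ≈ 0# → ¬ x * y ≈ 0#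
  *-≉0 {x} {y} x≉0 y≉0 xy≈0 with proj₂ isField x x≉0
  ... | x⁻¹ , xx⁻¹≈1 = y≉0 (begin
    y              ≈⟨ *-identityˡ y ⟨
    1# * y         ≈⟨ *-congʳ (trans (sym xx⁻¹≈1) (*-comm x x⁻¹)) ⟩
    (x⁻¹ * x) * y  ≈⟨ *-assoc x⁻¹ x y ⟩
    x⁻¹ * (x * y)  ≈⟨ *-congˡ xy≈0 ⟩
    x⁻¹ * 0#       ≈⟨ zeroʳ x⁻¹ ⟩
    0#             ∎)

  ^-≉0 : ∀ {x} → ¬ x ≈ 0# → ∀ k → ¬ x ^ k ≈ 0#
  ^-≉0 x≉0 zero = 1≉0
  ^-≉0 x≉0 (suc k) = *-≉0 x≉0 (^-≉0 x≉0 k)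

  ι-≉0 : ∀ {p s} → Prime p → D.HasChar K p → ¬ p ∣ s → ¬ ι s ≈ 0#
  ι-≉0 {p} {s} p-prime char p∤s ιs≈0 with Bézout.lemma s p
  ... | Bézout.result d g identity with prime⇒irreducible p-prime (GCD.gcd∣n g)
  ...   | inj₂ ≡.refl = p∤s (GCD.gcd∣m g)
  ...   | inj₁ ≡.refl = no-unit-combination identity
    where
    ι-multiple : ∀ {n} → ι n ≈ 0# → ∀ k → ι (k ℕ.* n) ≈ 0#
    ι-multiple {n} ιn≈0 k = trans (ι-* k n) (trans (*-congˡ ιn≈0) (zeroʳ _))

    1+m≢n : ∀ {m n} → ι m ≈ 0# → ι n ≈ 0# → suc m ≢ n
    1+m≢n {m} {n} ιm≈0 ιn≈0 1+m≡n = 1≉0 (begin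
      1#          ≈⟨ +-identityʳ 1# ⟨
      1# + 0#     ≈⟨ +-congˡ ιm≈0 ⟨
      ι (suc m)   ≡⟨ ≡.cong ι 1+m≡n ⟩
      ι n         ≈⟨ ιn≈0 ⟩
      0#          ∎)

    no-unit-combination : ¬ Bézout.Identity 1 s p
    no-unit-combination (Bézout.+- x y eq) = 1+m≢n (ι-multiple char y) (ι-multiple ιs≈0 x) eq
    no-unit-combination (Bézout.-+ x y eq) = 1+m≢n (ι-multiple ιs≈0 x) (ι-multiple char y) eq

module Bivariate {c ℓ : Level} (K : CommutativeRing c ℓ) where
  open CommutativeRing K
  open RingFacts K
  open FiniteSums K

  -- Convolution rings of sequences are power series rings, but every series occurring here has
  -- finite support.
  K[x] : CommutativeRing c ℓ
  K[x] = Convolution.convolutionRing K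

  K[x][λ] : CommutativeRing c ℓ
  K[x][λ] = Convolution.convolutionRing K[x]

  module Kx = Convolution K
  module Kxλ = Convolution K[x]
  open import Algebra.Properties.Semiring.Exp (CommutativeRing.semiring K[x][λ])
    using () renaming (_^_ to _^λ_; ^-congˡ to ^λ-congˡ; ^-assocʳ to ^λ-assocʳ)

  Ser : Set c
  Ser = D.Ser K

  infix 4 _≈ˢ_
  _≈ˢ_ : Ser → Ser → Set ℓ
  _≈ˢ_ = D._≈ˢ_ K

  infixl 6 _⊕_
  _⊕_ : Ser → Ser → Ser
  _⊕_ = D._⊕_ K

  infixl 7 _⊗_
  _⊗_ : Ser → Ser → Ser
  _⊗_ = D._⊗_ K

  infixr 8 _^ˢ_
  _^ˢ_ : Ser → ℕ → Ser
  _^ˢ_ = D._^ˢ_ K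

  const : Carrier → Ser
  const = D.const K

  one : Ser
  one = D.one K

  coeffλ : Ser → ℕ → Ser
  coeffλ = D.coeffλ K

  ≈ˢ-setoid : Setoid c ℓ
  ≈ˢ-setoid = CommutativeRing.setoid K[x][λ]

  module ≈ˢ = Setoid ≈ˢ-setoid
  module Kx≋ = Setoid (CommutativeRing.setoid K[x])

  ∑-at : ∀ m (F : ℕ → ℕ → Carrier) j → D.sumTo K[x] m F j ≡ ∑ m (λ a → F a j)
  ∑-at zero F j = ≡.refl
  ∑-at (suc m) F j = ≡.cong (_+ F (suc m) j) (∑-at m F j)

  ⊗≈⋆ : ∀ A B → A ⊗ B ≈ˢ A Kxλ.⋆ B
  ⊗≈⋆ A B m j = reflexive (≡.sym (∑-at m _ j))

  one≈δ₀ : one ≈ˢ Kxλ.δ₀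
  one≈δ₀ zero zero = refl
  one≈δ₀ zero (suc j) = refl
  one≈δ₀ (suc m) j = refl

  ^ˢ≈^λ : ∀ A n → A ^ˢ n ≈ˢ A ^λ n
  ^ˢ≈^λ A zero = one≈δ₀
  ^ˢ≈^λ A (suc n) = ≈ˢ.trans (⊗≈⋆ A (A ^ˢ n)) (Kxλ.⋆-cong (λ _ _ → refl) (^ˢ≈^λ A n))

  ⊗-cong : ∀ {A A′ B B′} → A ≈ˢ A′ → B ≈ˢ B′ → A ⊗ B ≈ˢ A′ ⊗ B′
  ⊗-cong {A} {A′} {B} {B′} A≈A′ B≈B′ =
    ≈ˢ.trans (⊗≈⋆ A B) (≈ˢ.trans (Kxλ.⋆-cong A≈A′ B≈B′) (≈ˢ.sym (⊗≈⋆ A′ B′)))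

  ⊗-identityʳ : ∀ A → A ⊗ one ≈ˢ A
  ⊗-identityʳ A = ≈ˢ.trans (⊗-cong (λ _ _ → refl) one≈δ₀)
                   (≈ˢ.trans (⊗≈⋆ A Kxλ.δ₀) (CommutativeRing.*-identityʳ K[x][λ] A))

  ^ˢ-cong : ∀ {A B} n → A ≈ˢ B → A ^ˢ n ≈ˢ B ^ˢ n
  ^ˢ-cong {A} {B} n A≈B = ≈ˢ.trans (^ˢ≈^λ A n) (≈ˢ.trans (^λ-congˡ n A≈B) (≈ˢ.sym (^ˢ≈^λ B n)))

  ^ˢ-* : ∀ A m n → A ^ˢ (m ℕ.* n) ≈ˢ (A ^ˢ m) ^ˢ n
  ^ˢ-* A m n = begin
    A ^ˢ (m ℕ.* n)   ≈⟨ ^ˢ≈^λ A (m ℕ.* n) ⟩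
    A ^λ (m ℕ.* n)   ≈⟨ ^λ-assocʳ A m n ⟨
    (A ^λ m) ^λ n    ≈⟨ ^λ-congˡ n (≈ˢ.sym (^ˢ≈^λ A m)) ⟩
    (A ^ˢ m) ^λ n    ≈⟨ ^ˢ≈^λ (A ^ˢ m) n ⟨
    (A ^ˢ m) ^ˢ n    ∎
    where open ≈-Reasoning ≈ˢ-setoid

  frobeniusˢ : ∀ {p} → Prime p → D.HasChar K p → ∀ l A B →
               (A ⊕ B) ^ˢ (p ℕ.^ l) ≈ˢ A ^ˢ (p ℕ.^ l) ⊕ B ^ˢ (p ℕ.^ l)
  frobeniusˢ {p} p-prime char l A B = begin
    (A ⊕ B) ^ˢ q             ≈⟨ ^ˢ≈^λ (A ⊕ B) q ⟩
    (A ⊕ B) ^λ q             ≈⟨ Characteristic.frobenius-^ K[x][λ] p-prime charλ l A B ⟩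
    A ^λ q ⊕ B ^λ q          ≈⟨ (λ m j → +-cong (^ˢ≈^λ A q m j) (^ˢ≈^λ B q m j)) ⟨
    A ^ˢ q ⊕ B ^ˢ q          ∎
    where
    open ≈-Reasoning ≈ˢ-setoid
    q = p ℕ.^ l
    charλ = Kxλ.convolution-HasChar p (Kx.convolution-HasChar p char)

  row₀-^ˢ : ∀ A k → (A ^ˢ k) 0 Kx.≋ A 0 Kx.^⋆ k
  row₀-^ˢ A zero = one≈δ₀ 0
  row₀-^ˢ A (suc k) = Kx.⋆-cong (λ _ → refl) (row₀-^ˢ A k)

  ⊗-coeff-zero : ∀ A B m j → (∀ a b → a ≤ m → b ≤ j → A a b * B (m ∸ a) (j ∸ b) ≈ 0#) →
                 (A ⊗ B) m j ≈ 0#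
  ⊗-coeff-zero A B m j terms≈0 = ∑-zero m (λ a a≤m → ∑-zero j (λ b b≤j → terms≈0 a b a≤m b≤j))

  ⊗-coeff-single : ∀ A B m j a₀ b₀ → a₀ ≤ m → b₀ ≤ j →
    (∀ a b → a ≤ m → b ≤ j → (a , b) ≢ (a₀ , b₀) → A a b * B (m ∸ a) (j ∸ b) ≈ 0#) →
    (A ⊗ B) m j ≈ A a₀ b₀ * B (m ∸ a₀) (j ∸ b₀)
  ⊗-coeff-single A B m j a₀ b₀ a₀≤m b₀≤j others =
    trans (∑-single m a₀ a₀≤m (λ a a≤m a≢a₀ → ∑-zero j (λ b b≤j →
                                 others a b a≤m b≤j (a≢a₀ ∘ ≡.cong proj₁))))
          (∑-single j b₀ b₀≤j (λ b b≤j b≢b₀ → others a₀ b a₀≤m b≤j (b≢b₀ ∘ ≡.cong proj₂)))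

  ⊗-coeff-pair : ∀ A B m j a₁ b₁ a₂ b₂ → a₁ < a₂ → a₂ ≤ m → b₁ ≤ j → b₂ ≤ j →
    (∀ a b → a ≤ m → b ≤ j → (a , b) ≢ (a₁ , b₁) → (a , b) ≢ (a₂ , b₂) →
       A a b * B (m ∸ a) (j ∸ b) ≈ 0#) →
    (A ⊗ B) m j ≈ A a₁ b₁ * B (m ∸ a₁) (j ∸ b₁) + A a₂ b₂ * B (m ∸ a₂) (j ∸ b₂)
  ⊗-coeff-pair A B m j a₁ b₁ a₂ b₂ a₁<a₂ a₂≤m b₁≤j b₂≤j others =
    trans (∑-pair m a₁ a₂ a₁<a₂ a₂≤m (λ a a≤m a≢a₁ a≢a₂ → ∑-zero j (λ b b≤j →
             others a b a≤m b≤j (a≢a₁ ∘ ≡.cong proj₁) (a≢a₂ ∘ ≡.cong proj₁))))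
          (+-cong (∑-single j b₁ b₁≤j (λ b b≤j b≢b₁ →
                     others a₁ b a₁≤m b≤j (b≢b₁ ∘ ≡.cong proj₂) (ℕₚ.<⇒≢ a₁<a₂ ∘ ≡.cong proj₁)))
                  (∑-single j b₂ b₂≤j (λ b b≤j b≢b₂ →
                     others a₂ b a₂≤m b≤j (ℕₚ.>⇒≢ a₁<a₂ ∘ ≡.cong proj₁) (b≢b₂ ∘ ≡.cong proj₂))))
    where a₁≤m = ℕₚ.<⇒≤ (ℕₚ.<-≤-trans a₁<a₂ a₂≤m)

  const⊗ : ∀ x A m j → (const x ⊗ A) m j ≈ x * A m j
  const⊗ x A m j = ⊗-coeff-single (const x) A m j 0 0 z≤n z≤n others
    where
    others : ∀ a b → a ≤ m → b ≤ j → (a , b) ≢ (0 , 0) → const x a b * A (m ∸ a) (j ∸ b) ≈ 0#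
    others zero zero _ _ ab≢00 = contradiction ≡.refl ab≢00
    others zero (suc b) _ _ _ = zeroˡ _
    others (suc a) b _ _ _ = zeroˡ _

  Weight : Set
  Weight = ℕ → ℕ → ℕ

  Additive : Weight → Set
  Additive w = ∀ {a b m j} → a ≤ m → b ≤ j → w m j ≡ w a b ℕ.+ w (m ∸ a) (j ∸ b)

  degλ : Weight
  degλ m j = m

  degx : Weight
  degx m j = j

  weighted : ℕ → Weight
  weighted d m j = d ℕ.* m ℕ.+ j

  degλ-additive : Additive degλ
  degλ-additive a≤m _ = ≡.sym (ℕₚ.m+[n∸m]≡n a≤m)

  degx-additive : Additive degx
  degx-additive _ b≤j = ≡.sym (ℕₚ.m+[n∸m]≡n b≤j)

  weighted-additive : ∀ d → Additive (weighted d)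
  weighted-additive d {a} {b} {m} {j} a≤m b≤j = begin
    d ℕ.* m ℕ.+ j
      ≡⟨ ≡.cong₂ (λ u v → d ℕ.* u ℕ.+ v) (ℕₚ.m+[n∸m]≡n a≤m) (ℕₚ.m+[n∸m]≡n b≤j) ⟨
    d ℕ.* (a ℕ.+ (m ∸ a)) ℕ.+ (b ℕ.+ (j ∸ b))
      ≡⟨ regroup d a b (m ∸ a) (j ∸ b) ⟩
    (d ℕ.* a ℕ.+ b) ℕ.+ (d ℕ.* (m ∸ a) ℕ.+ (j ∸ b)) ∎
    where
    open ≡.≡-Reasoning
    regroup : ∀ d a b m j → d ℕ.* (a ℕ.+ m) ℕ.+ (b ℕ.+ j) ≡ (d ℕ.* a ℕ.+ b) ℕ.+ (d ℕ.* m ℕ.+ j)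
    regroup = solve-∀

  Deg≤ : Weight → Ser → ℕ → Set ℓ
  Deg≤ w A N = ∀ m j → N < w m j → A m j ≈ 0#

  Deg< : Weight → Ser → ℕ → Set ℓ
  Deg< w A N = ∀ m j → N ≤ w m j → A m j ≈ 0#

  Deg≤-⊕ : ∀ {w A B N} → Deg≤ w A N → Deg≤ w B N → Deg≤ w (A ⊕ B) N
  Deg≤-⊕ degA degB m j N<w = trans (+-cong (degA m j N<w) (degB m j N<w)) (+-identityˡ 0#)

  Deg≤-mono : ∀ {w A N N′} → N ≤ N′ → Deg≤ w A N → Deg≤ w A N′
  Deg≤-mono N≤N′ degA m j N′<w = degA m j (ℕₚ.≤-<-trans N≤N′ N′<w)

  Deg≤-const⊗ : ∀ {w A N} x → Deg≤ w A N → Deg≤ w (const x ⊗ A) N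
  Deg≤-const⊗ {A = A} x degA m j N<w = trans (const⊗ x A m j) (y≈0⇒x*y≈0 (degA m j N<w))

  Deg<⇒Deg≤ : ∀ {w A N} → Deg< w A N → Deg≤ w A N
  Deg<⇒Deg≤ degA m j N<w = degA m j (ℕₚ.<⇒≤ N<w)

  module _ {w : Weight} (additive : Additive w) where

    Deg≤-⊗ : ∀ {A B N M} → Deg≤ w A N → Deg≤ w B M → Deg≤ w (A ⊗ B) (N ℕ.+ M)
    Deg≤-⊗ {A} {B} {N} {M} degA degB m j N+M<w = ⊗-coeff-zero A B m j term≈0
      where
      term≈0 : ∀ a b → a ≤ m → b ≤ j → A a b * B (m ∸ a) (j ∸ b) ≈ 0#
      term≈0 a b a≤m b≤j with N ℕₚ.<? w a b
      ... | yes N<w = x≈0⇒x*y≈0 (degA a b N<w)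
      ... | no N≮w = y≈0⇒x*y≈0 (degB (m ∸ a) (j ∸ b) (ℕₚ.+-cancelˡ-< N M _
                       (ℕₚ.<-≤-trans (≡.subst (N ℕ.+ M <_) (additive a≤m b≤j) N+M<w)
                                     (ℕₚ.+-monoˡ-≤ _ (ℕₚ.≮⇒≥ N≮w)))))

    Deg<-⊗ : ∀ {A B N M} → Deg< w A N → Deg≤ w B M → Deg< w (A ⊗ B) (N ℕ.+ M)
    Deg<-⊗ {A} {B} {N} {M} degA degB m j N+M≤w = ⊗-coeff-zero A B m j term≈0
      where
      term≈0 : ∀ a b → a ≤ m → b ≤ j → A a b * B (m ∸ a) (j ∸ b) ≈ 0#
      term≈0 a b a≤m b≤j with N ℕₚ.≤? w a b
      ... | yes N≤w = x≈0⇒x*y≈0 (degA a b N≤w)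
      ... | no N≰w = y≈0⇒x*y≈0 (degB (m ∸ a) (j ∸ b) (ℕₚ.+-cancelˡ-< N M _
                       (ℕₚ.≤-<-trans (≡.subst (N ℕ.+ M ≤_) (additive a≤m b≤j) N+M≤w)
                                     (ℕₚ.+-monoˡ-< _ (ℕₚ.≰⇒> N≰w)))))

    w00≡0 : w 0 0 ≡ 0
    w00≡0 = ≡.sym (ℕₚ.+-cancelˡ-≡ (w 0 0) 0 (w 0 0) (≡.trans (ℕₚ.+-identityʳ (w 0 0)) (additive z≤n z≤n)))

    Deg≤-one : Deg≤ w one 0
    Deg≤-one zero zero 0<w00 = contradiction (≡.subst (0 <_) w00≡0 0<w00) (ℕₚ.n≮n 0)
    Deg≤-one zero (suc j) _ = refl
    Deg≤-one (suc m) j _ = refl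

    Deg≤-^ : ∀ {A N} → Deg≤ w A N → ∀ k → Deg≤ w (A ^ˢ k) (k ℕ.* N)
    Deg≤-^ degA zero = Deg≤-one
    Deg≤-^ degA (suc k) = Deg≤-⊗ degA (Deg≤-^ degA k)

    Deg<-^ : ∀ {A N} → Deg< w A N → ∀ k → 0 < k → Deg< w (A ^ˢ k) (k ℕ.* N)
    Deg<-^ degA (suc k) _ = Deg<-⊗ degA (Deg≤-^ (Deg<⇒Deg≤ degA) k)

  Deg≤⇒Deg< : ∀ {w A N M} → N < M → Deg≤ w A N → Deg< w A M
  Deg≤⇒Deg< N<M degA m j M≤w = degA m j (ℕₚ.<-≤-trans N<M M≤w)

  col₀ : Ser → ℕ → Carrier
  col₀ A m = A m 0

  col₀-^ˢ : ∀ A k → col₀ (A ^ˢ k) Kx.≋ col₀ A Kx.^⋆ k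
  col₀-^ˢ A zero zero = refl
  col₀-^ˢ A zero (suc m) = refl
  col₀-^ˢ A (suc k) = Kx.⋆-cong (λ _ → refl) (col₀-^ˢ A k)

  const-λ-free : ∀ u → Deg≤ degλ (const u) 0
  const-λ-free u (suc m) j _ = refl

  coeffλ-λ-free : ∀ P m → Deg≤ degλ (coeffλ P m) 0
  coeffλ-λ-free P m (suc m′) j _ = refl

  coeffλ≈ : ∀ {P m F} → Deg≤ degλ F 0 → P m Kx.≋ F 0 → coeffλ P m ≈ˢ F
  coeffλ≈ degF row zero j = row j
  coeffλ≈ degF row (suc m′) j = sym (degF (suc m′) j (s≤s z≤n))

  Leading-⊕ : ∀ {A B e α} → Kxλ.Leading A e α → Deg< degλ B e → Kxλ.Leading (A ⊕ B) e α
  Leading-⊕ {A} {B} {e} LA degB = record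
    { vanishes-above = λ m e<m j →
        trans (+-cong (Kxλ.vanishes-above LA m e<m j) (degB m j (ℕₚ.<⇒≤ e<m))) (+-identityʳ 0#)
    ; leading = λ j → trans (+-congˡ (degB e j ℕₚ.≤-refl)) (trans (+-identityʳ _) (Kxλ.leading LA j))
    }

  Leading-⊕ˡ : ∀ {A B e α} → Deg< degλ A e → Kxλ.Leading B e α → Kxλ.Leading (A ⊕ B) e α
  Leading-⊕ˡ {A} {B} {e} degA LB = record
    { vanishes-above = λ m e<m j →
        trans (+-cong (degA m j (ℕₚ.<⇒≤ e<m)) (Kxλ.vanishes-above LB m e<m j)) (+-identityˡ 0#)
    ; leading = λ j → trans (+-congʳ (degA e j ℕₚ.≤-refl)) (trans (+-identityˡ _) (Kxλ.leading LB j))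
    }

  Concentrated : Ser → ℕ → Set ℓ
  Concentrated A b = ∀ m j → m ≢ b → A m j ≈ 0#

  Concentrated-⊗ : ∀ {A B a b} → Concentrated A a → Concentrated B b → Concentrated (A ⊗ B) (a ℕ.+ b)
  Concentrated-⊗ {A} {B} {a} {b} concA concB m j m≢a+b = ⊗-coeff-zero A B m j term≈0
    where
    term≈0 : ∀ a′ b′ → a′ ≤ m → b′ ≤ j → A a′ b′ * B (m ∸ a′) (j ∸ b′) ≈ 0#
    term≈0 a′ b′ a′≤m _ with a′ ℕₚ.≟ a
    ... | no a′≢a = x≈0⇒x*y≈0 (concA a′ b′ a′≢a)
    ... | yes ≡.refl = y≈0⇒x*y≈0 (concB (m ∸ a) (j ∸ b′) (λ m∸a≡b →
                         m≢a+b (≡.trans (≡.sym (ℕₚ.m+[n∸m]≡n a′≤m)) (≡.cong (a ℕ.+_) m∸a≡b))))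

  Concentrated-⊗-row : ∀ {A B a b} → Concentrated A a → (A ⊗ B) (a ℕ.+ b) Kx.≋ A a Kx.⋆ B b
  Concentrated-⊗-row {A} {B} {a} {b} concA j =
    trans (∑-single (a ℕ.+ b) a (ℕₚ.m≤m+n a b) (λ a′ _ a′≢a → ∑-zero j (λ b′ _ → x≈0⇒x*y≈0 (concA a′ b′ a′≢a))))
          (∑-cong j (λ b′ _ → *-congˡ (reflexive (≡.cong (λ i → B i (j ∸ b′)) (ℕₚ.m+n∸m≡n a b)))))

  Concentrated-one : Concentrated one 0
  Concentrated-one zero j 0≢0 = contradiction ≡.refl 0≢0
  Concentrated-one (suc m) j _ = refl

  Concentrated-^ : ∀ {A b} → Concentrated A b → ∀ k → Concentrated (A ^ˢ k) (k ℕ.* b)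
  Concentrated-^ concA zero = Concentrated-one
  Concentrated-^ concA (suc k) = Concentrated-⊗ concA (Concentrated-^ concA k)

  Concentrated-^-row : ∀ {A b} → Concentrated A b → ∀ k → (A ^ˢ k) (k ℕ.* b) Kx.≋ A b Kx.^⋆ k
  Concentrated-^-row concA zero = one≈δ₀ 0
  Concentrated-^-row {A} concA (suc k) =
    Kx≋.trans (Concentrated-⊗-row {B = A ^ˢ k} concA) (Kx.⋆-cong (λ _ → refl) (Concentrated-^-row concA k))

module MonicInλ {c ℓ : Level} (K : CommutativeRing c ℓ) where
  open CommutativeRing K
  open import Algebra.Properties.AbelianGroup +-abelianGroup using (xyx⁻¹≈y)
  open RingFacts K
  open Bivariate K
  open Characteristic K using (ι)

  infix 4 _≈ₓ_
  _≈ₓ_ : (ℕ → Carrier) → (ℕ → Carrier) → Set ℓ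
  u ≈ₓ v = ∀ j → 0 < j → u j ≈ v j

  coeffλ≈⊕const : ∀ {P m F} → Deg≤ degλ F 0 → P m ≈ₓ F 0 → ∃ λ u → coeffλ P m ≈ˢ F ⊕ const u
  coeffλ≈⊕const {P} {m} {F} degF row =
    P m 0 - F 0 0 , coeffλ≈ (Deg≤-⊕ degF (const-λ-free _)) row′
    where
    row′ : P m Kx.≋ (F ⊕ const (P m 0 - F 0 0)) 0
    row′ zero = sym (trans (sym (+-assoc _ _ _)) (xyx⁻¹≈y (F 0 0) (P m 0)))
    row′ (suc j) = trans (row (suc j) (s≤s z≤n)) (sym (+-identityʳ _))

  Leading-≈ₓ : ∀ {u v e α} → 0 < e → u ≈ₓ v → Kx.Leading v e α → Kx.Leading u e α
  Leading-≈ₓ 0<e u≈ₓv L = record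
    { vanishes-above = λ j e<j → trans (u≈ₓv j (ℕₚ.<-trans 0<e e<j)) (Kx.vanishes-above L j e<j)
    ; leading = trans (u≈ₓv _ 0<e) (Kx.leading L)
    }

  Leading-scale : ∀ {v e α} κ → Kx.Leading v e α → Kx.Leading (λ j → κ * v j) e (κ * α)
  Leading-scale κ L = record
    { vanishes-above = λ j e<j → y≈0⇒x*y≈0 (Kx.vanishes-above L j e<j)
    ; leading = *-congˡ (Kx.leading L)
    }

  ≈ₓ-reindex : ∀ (P : Ser) {i i′ : ℕ} {v : ℕ → Carrier} → i ≡ i′ → P i ≈ₓ v → P i′ ≈ₓ v
  ≈ₓ-reindex P ≡.refl Pi≈ₓv = Pi≈ₓv

  XFreeAbove : Ser → ℕ → Set ℓ
  XFreeAbove P b = ∀ m j → b < m → 0 < j → P m j ≈ 0#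

  record Monic (P : Ser) (D b : ℕ) : Set ℓ where
    field
      leading-one : Kxλ.Leading P D Kx.δ₀
      x-free-above : XFreeAbove P b
      b<D : b < D

    degλ≤ : Deg≤ degλ P D
    degλ≤ m j D<m = Kxλ.vanishes-above leading-one m D<m j

    leading-coeff : P D 0 ≈ 1#
    leading-coeff = Kxλ.leading leading-one 0

  open Monic public

  Monic-cong : ∀ {P P′ D b} → P ≈ˢ P′ → Monic P D b → Monic P′ D b
  Monic-cong P≈P′ M = record
    { leading-one = Kxλ.Leading-cong P≈P′ (λ _ → refl) (leading-one M)
    ; x-free-above = λ m j b<m 0<j → trans (sym (P≈P′ m j)) (x-free-above M m j b<m 0<j)
    ; b<D = b<D M
    }

  Monic-reindex : ∀ {P D D′ b b′} → D ≡ D′ → b ≡ b′ → Monic P D b → Monic P D′ b′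
  Monic-reindex ≡.refl ≡.refl M = M

  module _ {P T : Ser} {D E b c : ℕ} (MP : Monic P D b) (MT : Monic T E c)
           (b+E≡D+c : b ℕ.+ E ≡ D ℕ.+ c) where

    Monic-⊗ : Monic (P ⊗ T) (D ℕ.+ E) (b ℕ.+ E)
    Monic-⊗ = record
      { leading-one = Kxλ.Leading-cong (≈ˢ.sym (⊗≈⋆ P T)) (Kx.⋆-identityˡ Kx.δ₀)
                        (Kxλ.Leading-⋆ (leading-one MP) (leading-one MT))
      ; x-free-above = x-free
      ; b<D = ℕₚ.+-monoˡ-< E (b<D MP)
      }
      where
      x-free : XFreeAbove (P ⊗ T) (b ℕ.+ E)
      x-free m j b+E<m 0<j = ⊗-coeff-zero P T m j term≈0
        where
        term≈0 : ∀ a β → a ≤ m → β ≤ j → P a β * T (m ∸ a) (j ∸ β) ≈ 0#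
        term≈0 a (suc β) _ _ with b ℕₚ.<? a
        ... | yes b<a = x≈0⇒x*y≈0 (x-free-above MP a (suc β) b<a (s≤s z≤n))
        ... | no b≮a = y≈0⇒x*y≈0 (degλ≤ MT (m ∸ a) _ (+<⇒<∸ E a
                         (ℕₚ.≤-<-trans (ℕₚ.+-monoʳ-≤ E (ℕₚ.≮⇒≥ b≮a))
                                       (≡.subst (_< m) (ℕₚ.+-comm b E) b+E<m))))
        term≈0 a zero _ _ with D ℕₚ.<? a
        ... | yes D<a = x≈0⇒x*y≈0 (degλ≤ MP a 0 D<a)
        ... | no D≮a = y≈0⇒x*y≈0 (x-free-above MT (m ∸ a) j (+<⇒<∸ c a
                         (ℕₚ.≤-<-trans (ℕₚ.+-monoʳ-≤ c (ℕₚ.≮⇒≥ D≮a))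
                                       (≡.subst (_< m) (≡.trans b+E≡D+c (ℕₚ.+-comm D c)) b+E<m))) 0<j)

    Monic-⊗-row : (P ⊗ T) (b ℕ.+ E) ≈ₓ (λ j → P b j + T c j)
    Monic-⊗-row j 0<j =
      trans (⊗-coeff-pair P T (b ℕ.+ E) j b j D 0 (b<D MP) D≤b+E ℕₚ.≤-refl z≤n others)
            (+-cong from-row-b from-leading)
      where
      D≤b+E : D ≤ b ℕ.+ E
      D≤b+E = ≡.subst (D ≤_) (≡.sym b+E≡D+c) (ℕₚ.m≤m+n D c)

      from-row-b : P b j * T (b ℕ.+ E ∸ b) (j ∸ j) ≈ P b j
      from-row-b = trans (*-congˡ (trans (reflexive (≡.cong₂ T (ℕₚ.m+n∸m≡n b E) (ℕₚ.n∸n≡0 j)))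
                                         (leading-coeff MT)))
                         (*-identityʳ _)

      from-leading : P D 0 * T (b ℕ.+ E ∸ D) j ≈ T c j
      from-leading = trans (*-congʳ (leading-coeff MP))
                     (trans (*-identityˡ _)
                            (reflexive (≡.cong (λ i → T i j)
                               (≡.trans (≡.cong (_∸ D) b+E≡D+c) (ℕₚ.m+n∸m≡n D c)))))

      others : ∀ a β → a ≤ b ℕ.+ E → β ≤ j → (a , β) ≢ (b , j) → (a , β) ≢ (D , 0) →
               P a β * T (b ℕ.+ E ∸ a) (j ∸ β) ≈ 0#
      others a (suc β) _ 1+β≤j ≢row-b _ with ℕₚ.<-cmp a b
      ... | tri> _ _ b<a = x≈0⇒x*y≈0 (x-free-above MP a (suc β) b<a (s≤s z≤n))
      ... | tri< a<b _ _ = y≈0⇒x*y≈0 (degλ≤ MT _ _ (+<⇒<∸ E a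
                             (≡.subst (E ℕ.+ a <_) (ℕₚ.+-comm E b) (ℕₚ.+-monoʳ-< E a<b))))
      ... | tri≈ _ ≡.refl _ with suc β ℕₚ.≟ j
      ...   | yes ≡.refl = contradiction ≡.refl ≢row-b
      ...   | no 1+β≢j = y≈0⇒x*y≈0 (trans (reflexive (≡.cong (λ i → T i (j ∸ suc β)) (ℕₚ.m+n∸m≡n b E)))
                           (x-free-above MT E _ (b<D MT) (ℕₚ.m<n⇒0<n∸m (ℕₚ.≤∧≢⇒< 1+β≤j 1+β≢j))))
      others a zero _ _ _ ≢leading with ℕₚ.<-cmp a D
      ... | tri> _ _ D<a = x≈0⇒x*y≈0 (degλ≤ MP a 0 D<a)
      ... | tri≈ _ ≡.refl _ = contradiction ≡.refl ≢leading
      ... | tri< a<D _ _ = y≈0⇒x*y≈0 (x-free-above MT _ j (+<⇒<∸ c a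
                             (≡.subst (c ℕ.+ a <_) (≡.trans (ℕₚ.+-comm c D) (≡.sym b+E≡D+c))
                                      (ℕₚ.+-monoʳ-< c a<D))) 0<j)

  Monic-^ : ∀ {P D b} → Monic P D b → ∀ k → Monic (P ^ˢ suc k) (suc k ℕ.* D) (b ℕ.+ k ℕ.* D)
  Monic-^ {P} {D} {b} MP zero =
    Monic-reindex (≡.sym (ℕₚ.+-identityʳ D)) (≡.sym (ℕₚ.+-identityʳ b))
                  (Monic-cong (≈ˢ.sym (⊗-identityʳ P)) MP)
  Monic-^ {P} {D} {b} MP (suc k) = Monic-⊗ MP (Monic-^ MP k) (m+[n+o]≡n+[m+o] b D (k ℕ.* D))

  Monic-^-row : ∀ {P D b} → Monic P D b → ∀ k →
                (P ^ˢ suc k) (b ℕ.+ k ℕ.* D) ≈ₓ (λ j → ι (suc k) * P b j)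
  Monic-^-row {P} {D} {b} MP zero j _ = begin
    (P ⊗ one) (b ℕ.+ 0) j      ≡⟨ ≡.cong (λ i → (P ⊗ one) i j) (ℕₚ.+-identityʳ b) ⟩
    (P ⊗ one) b j              ≈⟨ ⊗-identityʳ P b j ⟩
    P b j                      ≈⟨ *-identityˡ _ ⟨
    1# * P b j                 ≈⟨ *-congʳ (+-identityʳ 1#) ⟨
    (1# + 0#) * P b j          ∎
    where open ≈-Reasoning setoid
  Monic-^-row {P} {D} {b} MP (suc k) j 0<j = begin
    (P ⊗ P ^ˢ suc k) (b ℕ.+ suc k ℕ.* D) j      ≈⟨ Monic-⊗-row MP (Monic-^ MP k) (m+[n+o]≡n+[m+o] b D _) j 0<j ⟩
    P b j + (P ^ˢ suc k) (b ℕ.+ k ℕ.* D) j     ≈⟨ +-congˡ (Monic-^-row MP k j 0<j) ⟩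
    P b j + ι (suc k) * P b j                   ≈⟨ +-congʳ (*-identityˡ _) ⟨
    1# * P b j + ι (suc k) * P b j              ≈⟨ distribʳ _ _ _ ⟨
    ι (suc (suc k)) * P b j                     ∎
    where open ≈-Reasoning setoid

  module FrobeniusPower {p : ℕ} (p-prime : Prime p) (char : D.HasChar K p)
                        {P : Ser} {D b : ℕ} (MP : Monic P D b) (l : ℕ) where
    open import Algebra.Properties.Semiring.Exp (CommutativeRing.semiring K[x])
      using () renaming (^-congˡ to ^⋆-congˡ)

    q : ℕ
    q = p ℕ.^ l

    0<q : 0 < q
    0<q = ℕₚ.m^n>0 p {{prime⇒nonZero p-prime}} l

    -- P = Q + A + R: the x-free part of P off the row λ^b, that row, and the x-dependent part
    -- below it.  Frobenius raises the three parts to the q-th power separately.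
    Q A R : Ser
    Q m zero with m ℕₚ.≟ b
    ... | yes _ = 0#
    ... | no _ = P m 0
    Q m (suc j) = 0#

    A m j with m ℕₚ.≟ b
    ... | yes _ = P m j
    ... | no _ = 0#

    R m zero = 0#
    R m (suc j) with m ℕₚ.<? b
    ... | yes _ = P m (suc j)
    ... | no _ = 0#

    decomposition : P ≈ˢ Q ⊕ A ⊕ R
    decomposition m zero with m ℕₚ.≟ b
    ... | yes _ = sym (trans (+-identityʳ _) (+-identityˡ _))
    ... | no _ = sym (trans (+-identityʳ _) (+-identityʳ _))
    decomposition m (suc j) with m ℕₚ.≟ b | m ℕₚ.<? b
    ... | yes m≡b | yes m<b = contradiction m≡b (ℕₚ.<⇒≢ m<b)
    ... | yes _ | no _ = sym (trans (+-identityʳ _) (+-identityˡ _))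
    ... | no _ | yes _ = sym (trans (+-congʳ (+-identityˡ _)) (+-identityˡ _))
    ... | no m≢b | no m≮b = trans (x-free-above MP m (suc j) (ℕₚ.≤∧≢⇒< (ℕₚ.≮⇒≥ m≮b) (m≢b ∘ ≡.sym)) (s≤s z≤n))
                                 (sym (trans (+-identityʳ _) (+-identityˡ _)))

    Q-x-free : Deg≤ degx Q 0
    Q-x-free m (suc j) _ = refl

    Q-leading : Kxλ.Leading Q D Kx.δ₀
    Q-leading = record { vanishes-above = vanishes ; leading = leading-row }
      where
      vanishes : ∀ m → D < m → ∀ j → Q m j ≈ 0#
      vanishes m D<m zero with m ℕₚ.≟ b
      ... | yes _ = refl
      ... | no _ = degλ≤ MP m 0 D<m
      vanishes m D<m (suc j) = refl
      leading-row : Q D Kx.≋ Kx.δ₀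
      leading-row zero with D ℕₚ.≟ b
      ... | yes D≡b = contradiction (≡.sym D≡b) (ℕₚ.<⇒≢ (b<D MP))
      ... | no _ = leading-coeff MP
      leading-row (suc j) = refl

    A-concentrated : Concentrated A b
    A-concentrated m j m≢b with m ℕₚ.≟ b
    ... | yes m≡b = contradiction m≡b m≢b
    ... | no _ = refl

    A-row : A b Kx.≋ P b
    A-row j with b ℕₚ.≟ b
    ... | yes _ = refl
    ... | no b≢b = contradiction ≡.refl b≢b

    R-below : Deg< degλ R b
    R-below m zero _ = refl
    R-below m (suc j) b≤m with m ℕₚ.<? b
    ... | yes m<b = contradiction b≤m (ℕₚ.<⇒≱ m<b)
    ... | no _ = refl

    P^q≈ : P ^ˢ q ≈ˢ Q ^ˢ q ⊕ A ^ˢ q ⊕ R ^ˢ q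
    P^q≈ m j = trans (^ˢ-cong q decomposition m j)
                     (trans (frobeniusˢ p-prime char l (Q ⊕ A) R m j)
                            (+-congʳ (frobeniusˢ p-prime char l Q A m j)))

    Q^q-x-free : Deg≤ degx (Q ^ˢ q) 0
    Q^q-x-free = Deg≤-mono (ℕₚ.≤-reflexive (ℕₚ.*-zeroʳ q)) (Deg≤-^ degx-additive Q-x-free q)

    Q^q-leading : Kxλ.Leading (Q ^ˢ q) (q ℕ.* D) Kx.δ₀
    Q^q-leading = Kxλ.Leading-cong (≈ˢ.sym (^ˢ≈^λ Q q)) (RingFacts.1^n≈1 K[x] q) (Kxλ.Leading-^ Q-leading q)

    A^q-concentrated : Concentrated (A ^ˢ q) (q ℕ.* b)
    A^q-concentrated = Concentrated-^ A-concentrated q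

    R^q-below : Deg< degλ (R ^ˢ q) (q ℕ.* b)
    R^q-below = Deg<-^ degλ-additive R-below q 0<q

    qb<qD : q ℕ.* b < q ℕ.* D
    qb<qD = ℕₚ.*-monoʳ-< q {{ℕ.>-nonZero 0<q}} (b<D MP)

    monic : Monic (P ^ˢ q) (q ℕ.* D) (q ℕ.* b)
    monic = Monic-cong (≈ˢ.sym P^q≈) (record
      { leading-one = Leading-⊕ (Leading-⊕ Q^q-leading A^q-above) R^q-above
      ; x-free-above = λ m j qb<m 0<j →
          0+0+0≈0 (Q^q-x-free m j 0<j) (A^q-concentrated m j (ℕₚ.>⇒≢ qb<m)) (R^q-below m j (ℕₚ.<⇒≤ qb<m))
      ; b<D = qb<qD
      })
      where
      A^q-above : Deg< degλ (A ^ˢ q) (q ℕ.* D)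
      A^q-above m j qD≤m = A^q-concentrated m j (ℕₚ.>⇒≢ (ℕₚ.<-≤-trans qb<qD qD≤m))
      R^q-above : Deg< degλ (R ^ˢ q) (q ℕ.* D)
      R^q-above m j qD≤m = R^q-below m j (ℕₚ.≤-trans (ℕₚ.<⇒≤ qb<qD) qD≤m)

    row : (P ^ˢ q) (q ℕ.* b) ≈ₓ P b Kx.^⋆ q
    row j 0<j = begin
      (P ^ˢ q) (q ℕ.* b) j                                          ≈⟨ P^q≈ (q ℕ.* b) j ⟩
      (Q ^ˢ q) (q ℕ.* b) j + (A ^ˢ q) (q ℕ.* b) j + (R ^ˢ q) (q ℕ.* b) j
        ≈⟨ +-cong (+-cong (Q^q-x-free _ j 0<j) (Concentrated-^-row A-concentrated q j))
                  (R^q-below _ j ℕₚ.≤-refl) ⟩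
      0# + (A b Kx.^⋆ q) j + 0#                                      ≈⟨ +-identityʳ _ ⟩
      0# + (A b Kx.^⋆ q) j                                           ≈⟨ +-identityˡ _ ⟩
      (A b Kx.^⋆ q) j                                                ≈⟨ ^⋆-congˡ q A-row j ⟩
      (P b Kx.^⋆ q) j                                                ∎
      where open ≈-Reasoning setoid

  module _ {p : ℕ} (p-prime : Prime p) (char : D.HasChar K p) {P : Ser} {D b : ℕ} (MP : Monic P D b)
           (l k : ℕ) where
    private
      q = p ℕ.^ l
      module F = FrobeniusPower p-prime char MP l

    P^[q*s]≈ : P ^ˢ (q ℕ.* suc k) ≈ˢ (P ^ˢ q) ^ˢ suc k
    P^[q*s]≈ = ^ˢ-* P q (suc k)

    Monic-^-q*s : Monic (P ^ˢ (q ℕ.* suc k)) (suc k ℕ.* (q ℕ.* D)) (q ℕ.* b ℕ.+ k ℕ.* (q ℕ.* D))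
    Monic-^-q*s = Monic-cong (≈ˢ.sym P^[q*s]≈) (Monic-^ F.monic k)

    Monic-^-q*s-row : (P ^ˢ (q ℕ.* suc k)) (q ℕ.* b ℕ.+ k ℕ.* (q ℕ.* D)) ≈ₓ (λ j → ι (suc k) * (P b Kx.^⋆ q) j)
    Monic-^-q*s-row j 0<j =
      trans (P^[q*s]≈ _ j) (trans (Monic-^-row F.monic k j 0<j) (*-congˡ (F.row j 0<j)))

module ExponentArithmetic (p ℓ₁ ℓ₂ k₁ k₂ : ℕ) (p-prime : Prime p)
    (d₁<d₂ : p ℕ.^ ℓ₁ ℕ.* suc k₁ < p ℕ.^ ℓ₂ ℕ.* suc k₂) (1≤k₂ : 1 ≤ k₂)
    (X₂<X₁ : p ℕ.^ ℓ₂ ℕ.* k₂ < p ℕ.^ ℓ₁ ℕ.* k₁) where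
  open import Data.Nat using (_+_; _*_; _^_)
  open ℕₚ.≤-Reasoning

  private instance
    p≢0 : ℕ.NonZero p
    p≢0 = prime⇒nonZero p-prime

  q₁ q₂ d₁ d₂ X₁ X₂ : ℕ
  q₁ = p ^ ℓ₁
  q₂ = p ^ ℓ₂
  d₁ = q₁ * suc k₁
  d₂ = q₂ * suc k₂
  X₁ = q₁ * k₁
  X₂ = q₂ * k₂

  0<q₁ : 0 < q₁
  0<q₁ = ℕₚ.m^n>0 p ℓ₁

  q₁<q₂ : q₁ < q₂
  q₁<q₂ = ℕₚ.+-cancelʳ-< X₂ q₁ q₂ (begin-strict
    q₁ + X₂   <⟨ ℕₚ.+-monoʳ-< q₁ X₂<X₁ ⟩
    q₁ + X₁   ≡⟨ ℕₚ.*-suc q₁ k₁ ⟨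
    d₁        <⟨ d₁<d₂ ⟩
    d₂        ≡⟨ ℕₚ.*-suc q₂ k₂ ⟩
    q₂ + X₂   ∎)

  ℓ₁≤ℓ₂ : ℓ₁ ≤ ℓ₂
  ℓ₁≤ℓ₂ with ℓ₁ ℕₚ.≤? ℓ₂
  ... | yes ℓ₁≤ℓ₂ = ℓ₁≤ℓ₂
  ... | no ℓ₁≰ℓ₂ = contradiction (ℕₚ.^-monoʳ-≤ p (ℕₚ.<⇒≤ (ℕₚ.≰⇒> ℓ₁≰ℓ₂))) (ℕₚ.<⇒≱ q₁<q₂)

  d₂≡q₁*w : d₂ ≡ q₁ * (p ^ (ℓ₂ ∸ ℓ₁) * suc k₂)
  d₂≡q₁*w = begin-equality
    p ^ ℓ₂ * suc k₂                            ≡⟨ ≡.cong (λ i → p ^ i * suc k₂) (ℕₚ.m+[n∸m]≡n ℓ₁≤ℓ₂) ⟨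
    p ^ (ℓ₁ + (ℓ₂ ∸ ℓ₁)) * suc k₂              ≡⟨ ≡.cong (_* suc k₂) (ℕₚ.^-distribˡ-+-* p ℓ₁ (ℓ₂ ∸ ℓ₁)) ⟩
    q₁ * p ^ (ℓ₂ ∸ ℓ₁) * suc k₂                ≡⟨ ℕₚ.*-assoc q₁ _ (suc k₂) ⟩
    q₁ * (p ^ (ℓ₂ ∸ ℓ₁) * suc k₂)              ∎

  -- q₁ divides both d₁ and d₂, so the gap d₂ - d₁ is at least q₁.
  d₁+q₁≤d₂ : d₁ + q₁ ≤ d₂
  d₁+q₁≤d₂ = begin
    d₁ + q₁            ≡⟨ ℕₚ.+-comm d₁ q₁ ⟩
    q₁ + d₁            ≡⟨ ℕₚ.*-suc q₁ (suc k₁) ⟨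
    q₁ * suc (suc k₁)  ≤⟨ ℕₚ.*-monoʳ-≤ q₁ (ℕₚ.*-cancelˡ-< q₁ (suc k₁) w (≡.subst (d₁ <_) d₂≡q₁*w d₁<d₂)) ⟩
    q₁ * w             ≡⟨ d₂≡q₁*w ⟨
    d₂                 ∎
    where w = p ^ (ℓ₂ ∸ ℓ₁) * suc k₂

  t r : ℕ
  t = X₁ ∸ X₂
  r = q₂ ∸ q₁

  X₁≡X₂+t : X₁ ≡ X₂ + t
  X₁≡X₂+t = ≡.sym (ℕₚ.m+[n∸m]≡n (ℕₚ.<⇒≤ X₂<X₁))

  q₂≡q₁+r : q₂ ≡ q₁ + r
  q₂≡q₁+r = ≡.sym (ℕₚ.m+[n∸m]≡n (ℕₚ.<⇒≤ q₁<q₂))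

  t+q₁≤r : t + q₁ ≤ r
  t+q₁≤r = ℕₚ.+-cancelˡ-≤ (q₁ + X₂) (t + q₁) r (begin
    (q₁ + X₂) + (t + q₁)    ≡⟨ regroup q₁ X₂ t ⟩
    (q₁ + (X₂ + t)) + q₁    ≡⟨ ≡.cong (λ x → q₁ + x + q₁) X₁≡X₂+t ⟨
    (q₁ + X₁) + q₁          ≡⟨ ≡.cong (_+ q₁) (ℕₚ.*-suc q₁ k₁) ⟨
    d₁ + q₁                 ≤⟨ d₁+q₁≤d₂ ⟩
    d₂                      ≡⟨ ℕₚ.*-suc q₂ k₂ ⟩
    q₂ + X₂                 ≡⟨ ≡.cong (_+ X₂) q₂≡q₁+r ⟩
    (q₁ + r) + X₂           ≡⟨ ℕₚ.+-assoc q₁ r X₂ ⟩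
    q₁ + (r + X₂)           ≡⟨ ≡.cong (q₁ +_) (ℕₚ.+-comm r X₂) ⟩
    q₁ + (X₂ + r)           ≡⟨ ℕₚ.+-assoc q₁ X₂ r ⟨
    (q₁ + X₂) + r           ∎)
    where
    regroup : ∀ q X t → (q + X) + (t + q) ≡ (q + (X + t)) + q
    regroup = solve-∀

  q₂≤X₂ : q₂ ≤ X₂
  q₂≤X₂ = ℕₚ.m≤m*n q₂ k₂ {{ℕ.>-nonZero 1≤k₂}}

  1<X₁ : 1 < X₁
  1<X₁ = ℕₚ.≤-<-trans (ℕₚ.≤-trans (ℕₚ.m^n>0 p ℓ₂) q₂≤X₂) X₂<X₁

  X₁<d₁ : X₁ < d₁
  X₁<d₁ = ≡.subst (X₁ <_) (≡.sym (ℕₚ.*-suc q₁ k₁)) (ℕₚ.m<n+m X₁ 0<q₁)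

  t<X₂ : t < X₂
  t<X₂ = begin-strict
    t          <⟨ ℕₚ.m<m+n t 0<q₁ ⟩
    t + q₁     ≤⟨ t+q₁≤r ⟩
    r          ≤⟨ ℕₚ.m≤n+m r q₁ ⟩
    q₁ + r     ≡⟨ q₂≡q₁+r ⟨
    q₂         ≤⟨ q₂≤X₂ ⟩
    X₂         ∎

  gap-base : t * d₂ < r * X₁
  gap-base = begin-strict
    t * d₂                          ≡⟨ ≡.cong (t *_) (≡.trans (ℕₚ.*-suc q₂ k₂) (≡.cong (_+ X₂) q₂≡q₁+r)) ⟩
    t * ((q₁ + r) + X₂)             ≡⟨ expand t q₁ r X₂ ⟩
    (t * q₁ + t * X₂) + r * t       <⟨ ℕₚ.+-monoˡ-< (r * t) (ℕₚ.+-monoˡ-< (t * X₂) t*q₁<q₁*X₂) ⟩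
    (q₁ * X₂ + t * X₂) + r * t      ≡⟨ ≡.cong (_+ r * t) (ℕₚ.*-distribʳ-+ X₂ q₁ t) ⟨
    (q₁ + t) * X₂ + r * t           ≤⟨ ℕₚ.+-monoˡ-≤ (r * t) (ℕₚ.*-monoˡ-≤ X₂ (≡.subst (_≤ r) (ℕₚ.+-comm t q₁) t+q₁≤r)) ⟩
    r * X₂ + r * t                  ≡⟨ ℕₚ.*-distribˡ-+ r X₂ t ⟨
    r * (X₂ + t)                    ≡⟨ ≡.cong (r *_) X₁≡X₂+t ⟨
    r * X₁                          ∎
    where
    expand : ∀ t q r X → t * ((q + r) + X) ≡ (t * q + t * X) + r * t
    expand = solve-∀
    t*q₁<q₁*X₂ : t * q₁ < q₁ * X₂
    t*q₁<q₁*X₂ = ≡.subst (_< q₁ * X₂) (ℕₚ.*-comm q₁ t) (ℕₚ.*-monoʳ-< q₁ {{ℕ.>-nonZero 0<q₁}} t<X₂)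

  gap-step : ∀ D b → b ≤ D → t * D < r * b → t * (d₂ * D) < r * (q₂ * b + k₂ * (q₂ * D))
  gap-step D b b≤D tD<rb = begin-strict
    t * (d₂ * D)                     ≡⟨ ℕₚ.*-comm t (d₂ * D) ⟩
    d₂ * D * t                       ≡⟨ ℕₚ.*-assoc d₂ D t ⟩
    d₂ * (D * t)                     ≡⟨ ≡.cong (d₂ *_) (ℕₚ.*-comm D t) ⟩
    d₂ * (t * D)                     <⟨ ℕₚ.*-monoʳ-< d₂ {{ℕ.>-nonZero 0<d₂}} tD<rb ⟩
    d₂ * (r * b)                     ≡⟨ ≡.cong (_* (r * b)) (ℕₚ.*-suc q₂ k₂) ⟩
    (q₂ + X₂) * (r * b)              ≡⟨ distribute q₂ k₂ r b ⟩
    r * (q₂ * b + k₂ * (q₂ * b))     ≤⟨ ℕₚ.*-monoʳ-≤ r (ℕₚ.+-monoʳ-≤ (q₂ * b) (ℕₚ.*-monoʳ-≤ k₂ (ℕₚ.*-monoʳ-≤ q₂ b≤D))) ⟩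
    r * (q₂ * b + k₂ * (q₂ * D))     ∎
    where
    0<d₂ : 0 < d₂
    0<d₂ = ℕₚ.≤-<-trans z≤n d₁<d₂
    distribute : ∀ q k r b → (q + q * k) * (r * b) ≡ r * (q * b + k * (q * b))
    distribute = solve-∀

  regime-i : ∀ D b → t * D < r * b → q₁ * b + k₁ * (q₁ * D) < q₂ * b + k₂ * (q₂ * D)
  regime-i D b tD<rb = begin-strict
    q₁ * b + k₁ * (q₁ * D)          ≡⟨ ≡.cong (λ x → q₁ * b + x) (≡.trans (swap k₁ q₁ D) (≡.cong (_* D) X₁≡X₂+t)) ⟩
    q₁ * b + (X₂ + t) * D           ≡⟨ regroupˡ q₁ b X₂ t D ⟩
    (q₁ * b + X₂ * D) + t * D       <⟨ ℕₚ.+-monoʳ-< (q₁ * b + X₂ * D) tD<rb ⟩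
    (q₁ * b + X₂ * D) + r * b       ≡⟨ regroupʳ q₁ b X₂ r D ⟩
    (q₁ + r) * b + X₂ * D           ≡⟨ ≡.cong₂ (λ x y → x * b + y) q₂≡q₁+r (swap k₂ q₂ D) ⟨
    q₂ * b + k₂ * (q₂ * D)          ∎
    where
    swap : ∀ k q D → k * (q * D) ≡ q * k * D
    swap = solve-∀
    regroupˡ : ∀ q b X t D → q * b + (X + t) * D ≡ (q * b + X * D) + t * D
    regroupˡ = solve-∀
    regroupʳ : ∀ q b X r D → (q * b + X * D) + r * b ≡ (q + r) * b + X * D
    regroupʳ = solve-∀

  regime-ii : q₂ * 0 + k₂ * (q₂ * 1) < q₁ * 0 + k₁ * (q₁ * 1)
  regime-ii = ≡.subst₂ _<_ (base-exponent q₂ k₂) (base-exponent q₁ k₁) X₂<X₁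
    where
    base-exponent : ∀ q k → q * k ≡ q * 0 + k * (q * 1)
    base-exponent = solve-∀

module Iteration {c ℓ : Level} (K : CommutativeRing c ℓ) (c₁ : CommutativeRing.Carrier K) (d₁ d₂ : ℕ) where
  open CommutativeRing K
  open RingFacts K
  open FiniteSums K
  open Bivariate K
  open MonicInλ K
  open D.Iter K d₁ d₂ c₁ public
  open import Algebra.Properties.Semiring.Exp (CommutativeRing.semiring K[x])
    using () renaming (^-congˡ to ^⋆-congˡ)

  X Λ : Ser
  X = D.X K
  Λ = D.Λ K

  X-λ-free : Deg≤ degλ X 0
  X-λ-free (suc m) j _ = refl

  X-col₀ : ∀ m → X m 0 ≈ 0#
  X-col₀ zero = refl
  X-col₀ (suc m) = refl

  X-leading : Kx.Leading (X 0) 1 1#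
  X-leading = record { vanishes-above = above ; leading = refl }
    where
    above : ∀ j → 1 < j → X 0 j ≈ 0#
    above zero ()
    above (suc zero) (s≤s ())
    above (suc (suc j)) _ = refl

  Λ-concentrated : Concentrated Λ 1
  Λ-concentrated zero j _ = refl
  Λ-concentrated (suc zero) j 1≢1 = contradiction ≡.refl 1≢1
  Λ-concentrated (suc (suc m)) j _ = refl

  Λ-x-free : Deg≤ degx Λ 0
  Λ-x-free zero (suc j) _ = refl
  Λ-x-free (suc zero) (suc j) _ = refl
  Λ-x-free (suc (suc m)) (suc j) _ = refl

  Λ-leading : Kxλ.Leading Λ 1 Kx.δ₀
  Λ-leading = record
    { vanishes-above = λ m 1<m j → Λ-concentrated m j (ℕₚ.>⇒≢ 1<m)
    ; leading = λ { zero → refl ; (suc j) → refl }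
    }

  row₀-fλAt : ∀ {P P′} → P 0 Kx.≋ P′ 0 → fλAt P 0 Kx.≋ fAt P′ 0
  row₀-fλAt {P} {P′} P≋P′ j =
    trans (+-identityʳ _) (+-cong (row₀-^ d₂ j) (Kx.⋆-cong (λ _ → refl) (row₀-^ d₁) j))
    where
    row₀-^ : ∀ k → (P ^ˢ k) 0 Kx.≋ (P′ ^ˢ k) 0
    row₀-^ k = Kx≋.trans (row₀-^ˢ P k) (Kx≋.trans (^⋆-congˡ k P≋P′) (Kx≋.sym (row₀-^ˢ P′ k)))

  row₀-fλIter : ∀ n → fλIter n 0 Kx.≋ fIter n 0
  row₀-fλIter zero j = refl
  row₀-fλIter (suc n) = row₀-fλAt (row₀-fλIter n)

  fAt-λ-free : ∀ {P} → Deg≤ degλ P 0 → Deg≤ degλ (fAt P) 0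
  fAt-λ-free degP = Deg≤-⊕ (power d₂) (Deg≤-const⊗ c₁ (power d₁))
    where power = λ k → Deg≤-mono (ℕₚ.≤-reflexive (ℕₚ.*-zeroʳ k)) (Deg≤-^ degλ-additive degP k)

  fIter-λ-free : ∀ n → Deg≤ degλ (fIter n) 0
  fIter-λ-free zero = X-λ-free
  fIter-λ-free (suc n) = fAt-λ-free (fIter-λ-free n)

  coeffλ-fλIter-zero : ∀ n → coeffλ (fλIter n) 0 ≈ˢ fIter n
  coeffλ-fλIter-zero n = coeffλ≈ (fIter-λ-free n) (row₀-fλIter n)

  X^-col₀ : ∀ k → 0 < k → ∀ m → (X ^ˢ k) m 0 ≈ 0#
  X^-col₀ (suc k) _ m = ∑-zero m (λ a _ → x≈0⇒x*y≈0 (X-col₀ a))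

  module _ (0<d₁ : 0 < d₁) (0<d₂ : 0 < d₂) where

    fAt-X-origin : fAt X 0 0 ≈ 0#
    fAt-X-origin = trans (+-cong (X^-col₀ d₂ 0<d₂ 0) (trans (const⊗ c₁ (X ^ˢ d₁) 0 0) (y≈0⇒x*y≈0 (X^-col₀ d₁ 0<d₁ 0))))
                         (+-identityʳ 0#)

    col₀-fλAt-X : col₀ (fλAt X) Kx.≋ col₀ Λ
    col₀-fλAt-X m = trans (+-congʳ (+-cong (X^-col₀ d₂ 0<d₂ m) (trans (const⊗ c₁ (X ^ˢ d₁) m 0)
                                                                        (y≈0⇒x*y≈0 (X^-col₀ d₁ 0<d₁ m)))))
                          (trans (+-congʳ (+-identityʳ 0#)) (+-identityˡ _))

    -- At x = 0 the polynomial f_λ^2 reduces to λ^d₂ + c₁ λ^d₁ + λ.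
    fλIter-2-col₀ : ∀ m → m ≢ 1 → m ≢ d₁ → m ≢ d₂ → fλIter 2 m 0 ≈ 0#
    fλIter-2-col₀ m m≢1 m≢d₁ m≢d₂ =
      0+0+0≈0 (power-col₀ d₂ m≢d₂) (trans (const⊗ c₁ (fλAt X ^ˢ d₁) m 0) (y≈0⇒x*y≈0 (power-col₀ d₁ m≢d₁))) (Λ-concentrated m 0 m≢1)
      where
      power-col₀ : ∀ d → m ≢ d → (fλAt X ^ˢ d) m 0 ≈ 0#
      power-col₀ d m≢d = begin
        (fλAt X ^ˢ d) m 0           ≈⟨ col₀-^ˢ (fλAt X) d m ⟩
        (col₀ (fλAt X) Kx.^⋆ d) m   ≈⟨ ^⋆-congˡ d col₀-fλAt-X m ⟩
        (col₀ Λ Kx.^⋆ d) m          ≈⟨ col₀-^ˢ Λ d m ⟨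
        (Λ ^ˢ d) m 0                ≈⟨ Concentrated-^ Λ-concentrated d m 0 (λ m≡d*1 → m≢d (≡.trans m≡d*1 (ℕₚ.*-identityʳ d))) ⟩
        0#                          ∎
        where open ≈-Reasoning setoid

  fλIter-weighted : d₁ ≤ d₂ → 0 < d₂ → ∀ n → Deg≤ (weighted d₂) (fλIter n) (d₂ ℕ.^ n)
  fλIter-weighted d₁≤d₂ 0<d₂ zero = X-weighted
    where
    X-weighted : Deg≤ (weighted d₂) X 1
    X-weighted zero zero _ = refl
    X-weighted zero (suc zero) 1<w = contradiction (≡.subst (1 <_) (≡.cong (ℕ._+ 1) (ℕₚ.*-zeroʳ d₂)) 1<w) (ℕₚ.n≮n 1)
    X-weighted zero (suc (suc j)) _ = refl
    X-weighted (suc m) j _ = refl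
  fλIter-weighted d₁≤d₂ 0<d₂ (suc n) =
    Deg≤-⊕ (Deg≤-⊕ (power d₂) (Deg≤-const⊗ c₁ (Deg≤-mono (ℕₚ.*-monoˡ-≤ (d₂ ℕ.^ n) d₁≤d₂) (power d₁))))
           (Deg≤-mono (ℕₚ.m≤m*n d₂ (d₂ ℕ.^ n) {{ℕₚ.m^n≢0 d₂ n {{ℕ.>-nonZero 0<d₂}}}}) Λ-weighted)
    where
    power = Deg≤-^ (weighted-additive d₂) (fλIter-weighted d₁≤d₂ 0<d₂ n)
    Λ-weighted : Deg≤ (weighted d₂) Λ d₂
    Λ-weighted zero j _ = refl
    Λ-weighted (suc zero) zero d₂<w =
      contradiction (≡.subst (d₂ <_) (≡.trans (ℕₚ.+-identityʳ _) (ℕₚ.*-identityʳ d₂)) d₂<w) (ℕₚ.n≮n d₂)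
    Λ-weighted (suc zero) (suc j) _ = refl
    Λ-weighted (suc (suc m)) j _ = refl

module Dominance {c ℓ : Level} (K : CommutativeRing c ℓ) {p : ℕ} (p-prime : Prime p) (char : D.HasChar K p)
    (c₁ : CommutativeRing.Carrier K) (ℓ₁ k₁ ℓ₂ k₂ : ℕ) where
  open CommutativeRing K
  open RingFacts K
  open Bivariate K
  open MonicInλ K
  open Characteristic K using (ι)

  q₁ q₂ d₁ d₂ : ℕ
  q₁ = p ℕ.^ ℓ₁
  q₂ = p ℕ.^ ℓ₂
  d₁ = q₁ ℕ.* suc k₁
  d₂ = q₂ ℕ.* suc k₂

  open Iteration K c₁ d₁ d₂ public

  module _ {P : Ser} {D b : ℕ} (MP : Monic P D b) (1≤D : 1 ≤ D) (d₁<d₂ : d₁ < d₂) where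

    B₁ B₂ : ℕ
    B₁ = q₁ ℕ.* b ℕ.+ k₁ ℕ.* (q₁ ℕ.* D)
    B₂ = q₂ ℕ.* b ℕ.+ k₂ ℕ.* (q₂ ℕ.* D)

    private
      M₁ : Monic (P ^ˢ d₁) (suc k₁ ℕ.* (q₁ ℕ.* D)) B₁
      M₁ = Monic-^-q*s p-prime char MP ℓ₁ k₁
      M₂ : Monic (P ^ˢ d₂) (suc k₂ ℕ.* (q₂ ℕ.* D)) B₂
      M₂ = Monic-^-q*s p-prime char MP ℓ₂ k₂

      d₁D<d₂D : suc k₁ ℕ.* (q₁ ℕ.* D) < d₂ ℕ.* D
      d₁D<d₂D = ≡.subst (_< d₂ ℕ.* D) (≡.sym ([1+s]*[q*D]≡q*[1+s]*D k₁ q₁ D)) (ℕₚ.*-monoˡ-< D {{ℕ.>-nonZero 1≤D}} d₁<d₂)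

      1<d₂D : 1 < d₂ ℕ.* D
      1<d₂D = ℕₚ.<-≤-trans (ℕₚ.≤-<-trans (ℕₚ.m^n>0 p {{prime⇒nonZero p-prime}} ℓ₁ ) (ℕₚ.≤-<-trans (ℕₚ.m≤m*n q₁ (suc k₁)) d₁<d₂))
                            (ℕₚ.m≤m*n d₂ D {{ℕ.>-nonZero 1≤D}})

    fλAt-monic : ∀ B → B₁ ≤ B → B₂ ≤ B → B < d₂ ℕ.* D → Monic (fλAt P) (d₂ ℕ.* D) B
    fλAt-monic B B₁≤B B₂≤B B<d₂D = record
      { leading-one = Leading-⊕ (Leading-⊕ leading₂ (Deg≤⇒Deg< d₁D<d₂D (Deg≤-const⊗ c₁ (degλ≤ M₁))))
                                (Deg≤⇒Deg< 1<d₂D (λ m j 1<m → Λ-concentrated m j (ℕₚ.>⇒≢ 1<m)))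
      ; x-free-above = λ m j B<m 0<j →
          0+0+0≈0 (x-free-above M₂ m j (ℕₚ.≤-<-trans B₂≤B B<m) 0<j)
                  (trans (const⊗ c₁ (P ^ˢ d₁) m j) (y≈0⇒x*y≈0 (x-free-above M₁ m j (ℕₚ.≤-<-trans B₁≤B B<m) 0<j)))
                  (Λ-x-free m j 0<j)
      ; b<D = B<d₂D
      }
      where
      leading₂ : Kxλ.Leading (P ^ˢ d₂) (d₂ ℕ.* D) Kx.δ₀
      leading₂ = ≡.subst (λ e → Kxλ.Leading (P ^ˢ d₂) e Kx.δ₀) ([1+s]*[q*D]≡q*[1+s]*D k₂ q₂ D) (leading-one M₂)

    fλAt-monic₂ : B₁ < B₂ → Monic (fλAt P) (d₂ ℕ.* D) B₂
    fλAt-monic₂ B₁<B₂ = fλAt-monic B₂ (ℕₚ.<⇒≤ B₁<B₂) ℕₚ.≤-refl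
      (≡.subst (B₂ <_) ([1+s]*[q*D]≡q*[1+s]*D k₂ q₂ D) (b<D M₂))

    fλAt-monic₁ : B₂ < B₁ → Monic (fλAt P) (d₂ ℕ.* D) B₁
    fλAt-monic₁ B₂<B₁ = fλAt-monic B₁ ℕₚ.≤-refl (ℕₚ.<⇒≤ B₂<B₁) (ℕₚ.<-trans (b<D M₁) d₁D<d₂D)

    fλAt-row₂ : B₁ < B₂ → fλAt P B₂ ≈ₓ (λ j → ι (suc k₂) * (P b Kx.^⋆ q₂) j)
    fλAt-row₂ B₁<B₂ j 0<j = trans
      (+-cong (+-cong (Monic-^-q*s-row p-prime char MP ℓ₂ k₂ j 0<j)
                      (trans (const⊗ c₁ (P ^ˢ d₁) B₂ j) (y≈0⇒x*y≈0 (x-free-above M₁ B₂ j B₁<B₂ 0<j))))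
              (Λ-x-free B₂ j 0<j))
      (trans (+-identityʳ _) (+-identityʳ _))

    fλAt-row₁ : B₂ < B₁ → fλAt P B₁ ≈ₓ (λ j → (c₁ * ι (suc k₁)) * (P b Kx.^⋆ q₁) j)
    fλAt-row₁ B₂<B₁ j 0<j = trans
      (+-cong (+-cong (x-free-above M₂ B₁ j B₂<B₁ 0<j)
                      (trans (const⊗ c₁ (P ^ˢ d₁) B₁ j) (*-congˡ (Monic-^-q*s-row p-prime char MP ℓ₁ k₁ j 0<j))))
              (Λ-x-free B₁ j 0<j))
      (trans (+-identityʳ _) (trans (+-identityˡ _) (sym (*-assoc _ _ _))))

module NonconstantLeadingTerm {c ℓ : Level} (K : CommutativeRing c ℓ) (isField : D.IsField K) where
  open CommutativeRing K
  open Bivariate K using (module Kx)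
  open MonicInλ K using (_≈ₓ_; Leading-≈ₓ; Leading-scale)
  open FieldProperties K isField
  open import Algebra.Properties.Semiring.Exp semiring using (_^_)
  open import Data.Product using (_×_)

  record NonconstantLeading (u : ℕ → Carrier) : Set (c ⊔ ℓ) where
    field
      degree : ℕ
      coefficient : Carrier
      0<degree : 0 < degree
      coefficient≉0 : ¬ coefficient ≈ 0#
      leading : Kx.Leading u degree coefficient

  open NonconstantLeading

  NonconstantLeading-^ : ∀ {u v κ} q → 0 < q → ¬ κ ≈ 0# → u ≈ₓ (λ j → κ * (v Kx.^⋆ q) j) →
                         NonconstantLeading v → NonconstantLeading u
  NonconstantLeading-^ {κ = κ} q 0<q κ≉0 u≈ₓκv^q N = record
    { degree = q ℕ.* degree N
    ; coefficient = κ * coefficient N ^ q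
    ; 0<degree = 0<qe
    ; coefficient≉0 = *-≉0 κ≉0 (^-≉0 (coefficient≉0 N) q)
    ; leading = Leading-≈ₓ 0<qe u≈ₓκv^q (Leading-scale κ (Kx.Leading-^ (leading N) q))
    }
    where
    0<qe : 0 < q ℕ.* degree N
    0<qe = m*n>0 0<q (0<degree N)

  nonzero-x-coefficient : ∀ {u} → NonconstantLeading u → ∃ λ j → 1 ≤ j × ¬ u j ≈ 0#
  nonzero-x-coefficient N =
    degree N , 0<degree N , λ u≈0 → coefficient≉0 N (trans (sym (Kx.leading (leading N))) u≈0)

module Lemma5p1 {c ℓ : Level} (K : CommutativeRing c ℓ) {p : ℕ} (p-prime : Prime p)
    (isField : D.IsField K) (char : D.HasChar K p)
    (c₁ : CommutativeRing.Carrier K) (c₁≉0 : ¬ CommutativeRing._≈_ K c₁ (CommutativeRing.0# K))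
    (ℓ₁ k₁ ℓ₂ k₂ : ℕ) (p∤s₁ : ¬ p ∣ suc k₁) (p∤s₂ : ¬ p ∣ suc k₂)
    (d₁<d₂ : p ℕ.^ ℓ₁ ℕ.* suc k₁ < p ℕ.^ ℓ₂ ℕ.* suc k₂) (1≤k₂ : 1 ≤ k₂)
    (X₂<X₁ : p ℕ.^ ℓ₂ ℕ.* k₂ < p ℕ.^ ℓ₁ ℕ.* k₁) where
  open CommutativeRing K
  open RingFacts K
  open Bivariate K
  open MonicInλ K
  open Characteristic K using (ι)
  open FieldProperties K isField
  open NonconstantLeadingTerm K isField
  open ExponentArithmetic p ℓ₁ ℓ₂ k₁ k₂ p-prime d₁<d₂ 1≤k₂ X₂<X₁
  open Dominance K p-prime char c₁ ℓ₁ k₁ ℓ₂ k₂ hiding (q₁; q₂; d₁; d₂)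
  open import Algebra.Properties.Semiring.Exp (CommutativeRing.semiring K[x])
    using () renaming (^-congˡ to ^⋆-congˡ)
  open import Data.Product using (_×_)

  b : ℕ → ℕ
  b = D.bSeq p ℓ₁ (suc k₁) ℓ₂ (suc k₂) d₂

  record Shape (k : ℕ) : Set (c ⊔ ℓ) where
    field
      monic : Monic (fλIter (suc k)) (d₂ ℕ.^ k) (b (suc k))
      row-nonconstant : NonconstantLeading (fλIter (suc k) (b (suc k)))

  open Shape

  -- The invariant under which the exponent B₂ of the q₂-term dominates from n = 2 on.
  Gap : ℕ → Set
  Gap k = t ℕ.* d₂ ℕ.^ k < r ℕ.* b (suc k)

  0<q₂ : 0 < q₂
  0<q₂ = ℕₚ.m^n>0 p {{prime⇒nonZero p-prime}} ℓ₂

  0<d₁ : 0 < d₁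
  0<d₁ = m*n>0 0<q₁ (s≤s z≤n)

  0<d₂ : 0 < d₂
  0<d₂ = ℕₚ.<-trans 0<d₁ d₁<d₂

  shape-1 : Shape 0
  shape-1 = record
    { monic = record
      { leading-one = Leading-⊕ˡ (Deg≤⇒Deg< (s≤s z≤n) (fAt-λ-free X-λ-free)) Λ-leading
      ; x-free-above = λ m j 0<m 0<j →
          trans (+-cong (fAt-λ-free X-λ-free m j 0<m) (Λ-x-free m j 0<j)) (+-identityʳ 0#)
      ; b<D = s≤s z≤n
      }
    ; row-nonconstant = record
      { degree = d₂
      ; coefficient = 1#
      ; 0<degree = 0<d₂
      ; coefficient≉0 = 1≉0
      ; leading = Kx.Leading-+ {fAt X 0} (Kx.Leading-+ {(X ^ˢ d₂) 0} (X^-leading d₂) lower) (λ _ _ → refl)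
      }
    }
    where
    X^-leading : ∀ d → Kx.Leading ((X ^ˢ d) 0) d 1#
    X^-leading d = ≡.subst (λ e → Kx.Leading ((X ^ˢ d) 0) e 1#) (ℕₚ.*-identityʳ d)
                     (Kx.Leading-cong (Kx≋.sym (row₀-^ˢ X d)) (1^n≈1 d) (Kx.Leading-^ X-leading d))
    lower : ∀ j → d₂ ≤ j → (const c₁ ⊗ X ^ˢ d₁) 0 j ≈ 0#
    lower j d₂≤j = trans (const⊗ c₁ (X ^ˢ d₁) 0 j)
                         (y≈0⇒x*y≈0 (Kx.vanishes-above (X^-leading d₁) j (ℕₚ.<-≤-trans d₁<d₂ d₂≤j)))

  B₁≡b₂ : q₁ ℕ.* 0 ℕ.+ k₁ ℕ.* (q₁ ℕ.* 1) ≡ b 2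
  B₁≡b₂ = B₁-at-base q₁ k₁
    where
    B₁-at-base : ∀ q k → q ℕ.* 0 ℕ.+ k ℕ.* (q ℕ.* 1) ≡ q ℕ.* k
    B₁-at-base = solve-∀

  row-2 : fλIter 2 (b 2) ≈ₓ (λ j → (c₁ * ι (suc k₁)) * (fλIter 1 0 Kx.^⋆ q₁) j)
  row-2 = ≈ₓ-reindex (fλIter 2) B₁≡b₂ (fλAt-row₁ (monic shape-1) (s≤s z≤n) d₁<d₂ regime-ii)

  shape-2 : Shape 1 × Gap 1
  shape-2 = record
    { monic = Monic-reindex ≡.refl B₁≡b₂ (fλAt-monic₁ M (s≤s z≤n) d₁<d₂ regime-ii)
    ; row-nonconstant = NonconstantLeading-^ q₁ 0<q₁ (*-≉0 c₁≉0 (ι-≉0 p-prime char p∤s₁)) row-2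
                                             (row-nonconstant shape-1)
    }
    , ≡.subst (λ D → t ℕ.* D < r ℕ.* b 2) (≡.sym (ℕₚ.*-identityʳ d₂)) gap-base
    where M = monic shape-1

  module Step (k : ℕ) (S : Shape (suc k)) (gap : Gap (suc k)) where
    M = monic S
    D = d₂ ℕ.^ suc k
    β = b (2 ℕ.+ k)

    1≤D : 1 ≤ D
    1≤D = ℕₚ.m^n>0 d₂ {{ℕ.>-nonZero 0<d₂}} (suc k)

    regime : B₁ M 1≤D d₁<d₂ < B₂ M 1≤D d₁<d₂
    regime = regime-i D β gap

    B₂≡b : q₂ ℕ.* β ℕ.+ k₂ ℕ.* (q₂ ℕ.* D) ≡ b (3 ℕ.+ k)
    B₂≡b = B₂-form q₂ β k₂ D
      where
      B₂-form : ∀ q β k D → q ℕ.* β ℕ.+ k ℕ.* (q ℕ.* D) ≡ q ℕ.* (D ℕ.* k ℕ.+ β)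
      B₂-form = solve-∀

    row : fλIter (3 ℕ.+ k) (b (3 ℕ.+ k)) ≈ₓ (λ j → ι (suc k₂) * (fλIter (2 ℕ.+ k) β Kx.^⋆ q₂) j)
    row = ≈ₓ-reindex (fλIter (3 ℕ.+ k)) B₂≡b (fλAt-row₂ M 1≤D d₁<d₂ regime)

    next : Shape (suc (suc k)) × Gap (suc (suc k))
    next = record
      { monic = Monic-reindex ≡.refl B₂≡b (fλAt-monic₂ M 1≤D d₁<d₂ regime)
      ; row-nonconstant = NonconstantLeading-^ q₂ 0<q₂ (ι-≉0 p-prime char p∤s₂) row (row-nonconstant S)
      }
      , ≡.subst (λ B → t ℕ.* (d₂ ℕ.* D) < r ℕ.* B) B₂≡b (gap-step D β (ℕₚ.<⇒≤ (b<D M)) gap)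

  shapes : ∀ k → Shape (suc k) × Gap (suc k)
  shapes zero = shape-2
  shapes (suc k) = Step.next k (proj₁ (shapes k)) (proj₂ (shapes k))

  shape : ∀ k → Shape k
  shape zero = shape-1
  shape (suc k) = proj₁ (shapes k)

  coeffλ-index : ∀ P {i i′} → i ≡ i′ → coeffλ P i ≈ˢ coeffλ P i′
  coeffλ-index P ≡.refl m j = refl

  a₂-claim : coeffλ (fλIter 2) (b 2) ≈ˢ const (c₁ * ι (suc k₁)) ⊗ fAt X ^ˢ q₁
  a₂-claim = coeffλ≈ F-λ-free row
    where
    open import Relation.Binary.Reasoning.Setoid setoid
    κ₁ = c₁ * ι (suc k₁)
    F = const κ₁ ⊗ fAt X ^ˢ q₁

    F-λ-free : Deg≤ degλ F 0
    F-λ-free = Deg≤-const⊗ κ₁ (Deg≤-mono (ℕₚ.≤-reflexive (ℕₚ.*-zeroʳ q₁))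
                                          (Deg≤-^ degλ-additive (fAt-λ-free X-λ-free) q₁))

    F-origin : F 0 0 ≈ 0#
    F-origin = trans (const⊗ κ₁ (fAt X ^ˢ q₁) 0 0) (y≈0⇒x*y≈0 (power-origin q₁ 0<q₁))
      where
      power-origin : ∀ k → 0 < k → (fAt X ^ˢ k) 0 0 ≈ 0#
      power-origin (suc k) _ = x≈0⇒x*y≈0 (fAt-X-origin 0<d₁ 0<d₂)

    row : fλIter 2 (b 2) Kx.≋ F 0
    row zero = trans (fλIter-2-col₀ 0<d₁ 0<d₂ (b 2) (ℕₚ.>⇒≢ 1<X₁) (ℕₚ.<⇒≢ X₁<d₁)
                                     (ℕₚ.<⇒≢ (ℕₚ.<-trans X₁<d₁ d₁<d₂)))
                     (sym F-origin)
    row (suc j) = begin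
      fλIter 2 (b 2) (suc j)             ≈⟨ row-2 (suc j) (s≤s z≤n) ⟩
      κ₁ * (fλIter 1 0 Kx.^⋆ q₁) (suc j)  ≈⟨ *-congˡ (^⋆-congˡ q₁ (row₀-fλIter 1) (suc j)) ⟩
      κ₁ * (fAt X 0 Kx.^⋆ q₁) (suc j)     ≈⟨ *-congˡ (row₀-^ˢ (fAt X) q₁ (suc j)) ⟨
      κ₁ * (fAt X ^ˢ q₁) 0 (suc j)        ≈⟨ const⊗ κ₁ (fAt X ^ˢ q₁) 0 (suc j) ⟨
      F 0 (suc j)                         ∎

  a-recursion : ∀ k → 2 ≤ suc k → ∃ λ u →
    cc (suc (suc k)) (d₂ ℕ.^ suc k ∸ b (suc (suc k)))
      ≈ˢ const (ι (suc k₂)) ⊗ cc (suc k) (d₂ ℕ.^ k ∸ b (suc k)) ^ˢ q₂ ⊕ const u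
  a-recursion zero (s≤s ())
  a-recursion (suc k) _ =
    proj₁ solution ,
    ≈ˢ.trans (coeffλ-index (fλIter (3 ℕ.+ k)) (ℕₚ.m∸[m∸n]≡n (ℕₚ.<⇒≤ (b<D (monic (proj₁ next))))))
             (≈ˢ.trans (proj₂ solution)
                       (λ m j → +-congʳ (⊗-cong {const (ι (suc k₂))} ≈ˢ.refl
                                  (^ˢ-cong q₂ (coeffλ-index (fλIter (2 ℕ.+ k)) (≡.sym (ℕₚ.m∸[m∸n]≡n (ℕₚ.<⇒≤ (b<D M)))))) m j)))
    where
    open Step k (proj₁ (shapes k)) (proj₂ (shapes k))
    A = coeffλ (fλIter (2 ℕ.+ k)) β
    F = const (ι (suc k₂)) ⊗ A ^ˢ q₂

    F-λ-free : Deg≤ degλ F 0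
    F-λ-free = Deg≤-const⊗ (ι (suc k₂)) (Deg≤-mono (ℕₚ.≤-reflexive (ℕₚ.*-zeroʳ q₂))
                                                   (Deg≤-^ degλ-additive (coeffλ-λ-free _ β) q₂))

    row′ : fλIter (3 ℕ.+ k) (b (3 ℕ.+ k)) ≈ₓ F 0
    row′ j 0<j = trans (row j 0<j) (sym (trans (const⊗ _ (A ^ˢ q₂) 0 j) (*-congˡ (row₀-^ˢ A q₂ j))))

    solution = coeffλ≈⊕const F-λ-free row′

  conclusion : ∀ k → D.Lemma5p1Conclusion K p c₁ d₁ d₂ ℓ₁ ℓ₂ (suc k₁) (suc k₂) (suc k)
  conclusion k =
      degλ≤ M
    , coeffλ≈ (const-λ-free 1#) (λ j → trans (Kxλ.leading (leading-one M) j) (sym (one≈δ₀ 0 j)))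
    , ≈ˢ.trans (coeffλ-index (fλIter (suc k)) (ℕₚ.n∸n≡0 D)) (coeffλ-fλIter-zero (suc k))
    , (λ i j i≤D d₂i<j → fλIter-weighted (ℕₚ.<⇒≤ d₁<d₂) 0<d₂ (suc k) (D ∸ i) j (weight-bound i j i≤D d₂i<j))
    , ℕₚ.<⇒≤ (b<D M)
    , nonzero-x-coefficient (row-nonconstant (shape k))
    , x-free-above M
    , (λ { ≡.refl → coeffλ-fλIter-zero 1 })
    , (λ { ≡.refl → ≈ˢ.trans (coeffλ-index (fλIter 2) (ℕₚ.m∸[m∸n]≡n (ℕₚ.<⇒≤ (b<D (monic (shape 1)))))) a₂-claim })
    , a-recursion k
    where
    M = monic (shape k)
    D = d₂ ℕ.^ k
    weight-bound : ∀ i j → i ≤ D → d₂ ℕ.* i < j → d₂ ℕ.* D < d₂ ℕ.* (D ∸ i) ℕ.+ j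
    weight-bound i j i≤D d₂i<j = ≡.subst (_< d₂ ℕ.* (D ∸ i) ℕ.+ j) split (ℕₚ.+-monoʳ-< (d₂ ℕ.* (D ∸ i)) d₂i<j)
      where
      split : d₂ ℕ.* (D ∸ i) ℕ.+ d₂ ℕ.* i ≡ d₂ ℕ.* D
      split = ≡.trans (≡.sym (ℕₚ.*-distribˡ-+ d₂ (D ∸ i) i)) (≡.cong (d₂ ℕ.*_) (ℕₚ.m∸n+n≡m i≤D))

open import Data.Nat using (_*_; _^_)

lemma5p1 : ∀ {c ℓ : Level} (K : CommutativeRing c ℓ) (p : ℕ) → Prime p →
    IsAlgClosureOfFp K p →
    (c₁ : CommutativeRing.Carrier K) →
    ¬ (CommutativeRing._≈_ K c₁ (CommutativeRing.0# K)) →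
    (d₁ d₂ ℓ₁ ℓ₂ s₁ s₂ : ℕ) → 1 ≤ d₁ → d₁ < d₂ →
    d₁ ≡ p ^ ℓ₁ * s₁ → ¬ (p ∣ s₁) → d₂ ≡ p ^ ℓ₂ * s₂ → ¬ (p ∣ s₂) →
    1 < s₂ → p ^ ℓ₂ * (s₂ ∸ 1) < p ^ ℓ₁ * (s₁ ∸ 1) →
    (n : ℕ) → 1 ≤ n → Lemma5p1Conclusion K p c₁ d₁ d₂ ℓ₁ ℓ₂ s₁ s₂ n
lemma5p1 K p p-prime (isField , char , _) c₁ c₁≉0 _ _ ℓ₁ ℓ₂ (suc k₁) (suc (suc k₂)) _ d₁<d₂ ≡.refl p∤s₁ ≡.refl p∤s₂
         _ X₂<X₁ (suc k) _ =
  Lemma5p1.conclusion K p-prime isField char c₁ c₁≉0 ℓ₁ k₁ ℓ₂ (suc k₂) p∤s₁ p∤s₂ d₁<d₂ (s≤s z≤n) X₂<X₁ k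
lemma5p1 _ p _ _ _ _ _ _ ℓ₁ _ zero _ 1≤d₁ _ ≡.refl _ _ _ _ _ _ _ =
  contradiction (≡.subst (1 ≤_) (ℕₚ.*-zeroʳ (p ^ ℓ₁)) 1≤d₁) (ℕₚ.n≮n 0)
lemma5p1 _ _ _ _ _ _ _ _ _ _ (suc _) zero _ _ _ _ _ _ () _ _ _
lemma5p1 _ _ _ _ _ _ _ _ _ _ (suc _) (suc zero) _ _ _ _ _ _ (s≤s ()) _ _ _
lemma5p1 _ _ _ _ _ _ _ _ _ _ (suc _) (suc (suc _)) _ _ _ _ _ _ _ _ zero ()
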